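{- Let $\mathcal{A}$ be a primitive integral Apollonian circle packing and let $\mathcal{C},\mathcal{C}'$ be circles of $\mathcal{A}$. Then there is a finite sequence of circles $\mathcal{C}=\mathcal{C}_0,\mathcal{C}_1,\dots,\mathcal{C}_m=\mathcal{C}'$ of $\mathcal{A}$ such that for each $j$, $\mathcal{C}_j$ and $\mathcal{C}_{j+1}$ are tangent and have coprime curvatures.
   Context: Apollonian packings: start from four mutually tangent circles in the plane (lines allowed) and repeatedly add, for every triple of mutually tangent circles present, the two circles tangent to all three. Curvatures are signed ($1/\text{radius}$; lines $0$; a circle containing the others in its interior is negative). Primitive integral: all curvatures integers with overall gcd $1$.
   Formalization: The circles and lines of the packing $\mathcal{A}$, including $\mathcal{C}$ and $\mathcal{C}'$, have rational augmented curvature-centre coordinates. -}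

module Defs where

open import Data.Nat using (ℕ; zero; suc)
open import Data.Integer using (ℤ; +_)
import Data.Integer as ℤ
open import Data.Rational using (ℚ; _/_; _+_; _*_; _-_; -_; 1ℚ)
open import Data.Fin using (Fin)
open import Data.Vec using (Vec; lookup)
open import Data.Product using (∃; _×_)
open import Relation.Binary.PropositionalEquality using (_≡_)
open import Relation.Nullary using (¬_)

-- An oriented circle (or line) in the plane, in augmented curvature-center
-- coordinates (Lagarias–Mallows–Wilks):
--   bbar = curvature of the image under inversion in the unit circle
--   b    = signed curvature
--   bx , by = curvature × centre (for a line: unit normal vector)
-- with rational coordinates.
record Circle : Set where
  constructor circle
  field
    bbar : ℚ
    curv : ℚ
    bx   : ℚ
    by   : ℚ
open Circle public

two : ℚ
two = + 2 / 1

-- Twice the Lorentz bilinear form  ⟨w,w'⟩ = ½(b b̄' + b̄ b') − (bx bx' + by by').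
form2 : Circle → Circle → ℚ
form2 w w' = (curv w * bbar w' + bbar w * curv w') - two * (bx w * bx w' + by w * by w')

-- A vector of ℚ⁴ is a genuine (oriented) circle/line iff ⟨w,w⟩ = −1.
IsCircle : Circle → Set
IsCircle w = form2 w w ≡ - two

-- Two oriented circles are tangent (with disjoint interiors) iff ⟨w,w'⟩ = 1,
-- i.e. |x − x'|² = (1/b + 1/b')² for circles.
Tangent : Circle → Circle → Set
Tangent w w' = form2 w w' ≡ two

IsDescartes : Vec Circle 4 → Set
IsDescartes D = (∀ i → IsCircle (lookup D i))
              × (∀ i j → ¬ (i ≡ j) → Tangent (lookup D i) (lookup D j))

data InPacking (D : Vec Circle 4) : Circle → Set where
  initial : (i : Fin 4) → InPacking D (lookup D i)
  add     : (a b c w : Circle) →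
            InPacking D a → InPacking D b → InPacking D c →
            Tangent a b → Tangent b c → Tangent a c →
            IsCircle w → Tangent w a → Tangent w b → Tangent w c →
            InPacking D w

IsInteger : ℚ → Set
IsInteger q = ∃ λ (z : ℤ) → q ≡ z / 1

_∣ℚ_ : ℕ → ℚ → Set
d ∣ℚ q = ∃ λ (k : ℤ) → q ≡ ((+ d) ℤ.* k) / 1

Integral : Vec Circle 4 → Set
Integral D = ∀ w → InPacking D w → IsInteger (curv w)

Primitive : Vec Circle 4 → Set
Primitive D = ∀ (d : ℕ) → (∀ w → InPacking D w → d ∣ℚ curv w) → d ≡ 1

CoprimeQ : ℚ → ℚ → Set
CoprimeQ p q = ∀ (d : ℕ) → d ∣ℚ p → d ∣ℚ q → d ≡ 1

{-# OPTIONS --safe #-}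
-- The Gram matrix of a Descartes
-- quadruple q₁, …, q₄ is 2J − 4I, so the qᵢ form a basis and expanding in it gives
--   8 form2 u v = (Σ form2 u qᵢ)(Σ form2 qᵢ v) − 2 Σ form2 u qᵢ · form2 qᵢ v.
-- Pairing with e₁ (on which form2 is the curvature) this contains the Descartes relation. By induction
-- on the packing all values form2 u v are ≡ 2 (mod 4); the expansion then writes every curvature as an
-- integer combination of the curvatures of any quadruple of the packing, so by primitivity no prime
-- divides three curvatures of a quadruple.
-- The circles tangent to two tangent circles of curvatures A, B ≠ 0 have curvatures
-- C₀ + n (C₁ − C₀) + n (n − 1)(A + B), and a Chinese-remainder choice of n makes one of them coprime
-- to A B. A line is tangent to a circle of curvature ±1, found by Descartes descent. Every circle is
-- then joined to a fixed non-line circle of the root quadruple by induction on the packing.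

module Submission where

open import Defs
open import Data.Nat using (ℕ; suc)
open import Data.Fin using (Fin; zero; suc; fromℕ; inject₁)
open import Data.Vec using (Vec)
open import Data.Product using (Σ; _×_)
open import Relation.Binary.PropositionalEquality using (_≡_)

open import Algebra.Bundles.Raw using (RawRing)
open import Data.Empty using (⊥; ⊥-elim)
open import Data.Fin.Properties using (_≟_)
open import Data.Integer as ℤ using (ℤ; +_; -[1+_])
import Data.Integer.DivMod as ℤ
open import Data.Integer.Divisibility.Signed as ℤ using (divides)
import Data.Integer.Properties as ℤ
import Data.Integer.Solver
open import Data.Integer.Tactic.RingSolver using (solve-∀)
open import Data.List as List using (filter)
open import Data.List.Membership.Propositional.Properties using (∈-filter⁺; ∈-filter⁻)
import Data.List.Relation.Unary.All as All
open import Data.List.Relation.Unary.All.Properties using (filter⁺)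
open import Data.Nat as ℕ using (zero; _≤_; _<_; s≤s; z≤n)
open import Data.Nat.Coprimality as Coprimality using (Coprime; coprime-Bézout)
open import Data.Nat.Divisibility as ℕ using (_∣?_)
open import Data.Nat.GCD using (module Bézout)
open import Data.Nat.ListAction using (product)
open import Data.Nat.ListAction.Properties using (∈⇒∣product)
open import Data.Nat.Primality using (Prime; euclidsLemma; prime⇒nonTrivial; productOfPrimes≢0)
open import Data.Nat.Primality.Factorisation using (factorise; factorisationHasAllPrimeFactors; PrimeFactorisation)
import Data.Nat.Properties as ℕ
import Data.Nat.Tactic.RingSolver as ℕ-Solver
open import Data.Product using (_,_; proj₁; proj₂; ∃)
import Data.Rational.Solver
import Data.Rational.Unnormalised as ℚᵘ
import Data.Rational.Unnormalised.Properties as ℚᵘ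
open import Data.Sum using (_⊎_; inj₁; inj₂; [_,_]′; reduce)
open import Data.Vec using (lookup)
import Data.Vec.Functional as Vector
open import Level using (0ℓ)
open import Relation.Binary.PropositionalEquality using (_≢_; refl; sym; trans; cong; cong₂; subst; module ≡-Reasoning)
open import Relation.Nullary using (¬_; yes; no; ¬?)

-- Polynomials are written once over an arbitrary raw ring: instantiated at ℚ they
-- are the functions used below, instantiated at solver syntax they are the
-- expressions handed to the ring solver.
module Polynomials {c ℓ} (R : RawRing c ℓ) where
  open RawRing R

  -- form2 in the coordinates (bbar, curv, bx, by), with t standing for two

  pairing : (t a₁ a₂ a₃ a₄ b₁ b₂ b₃ b₄ : Carrier) → Carrier
  pairing t a₁ a₂ a₃ a₄ b₁ b₂ b₃ b₄ = (a₂ * b₁ + a₁ * b₂) + - (t * (a₃ * b₃ + a₄ * b₄))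

  det₃ : (a₁ a₂ a₃ b₁ b₂ b₃ c₁ c₂ c₃ : Carrier) → Carrier
  det₃ a₁ a₂ a₃ b₁ b₂ b₃ c₁ c₂ c₃ =
    a₁ * (b₂ * c₃ + - (b₃ * c₂)) + - (a₂ * (b₁ * c₃ + - (b₃ * c₁))) + a₃ * (b₁ * c₂ + - (b₂ * c₁))

  det₄ : (a₁ a₂ a₃ a₄ b₁ b₂ b₃ b₄ c₁ c₂ c₃ c₄ d₁ d₂ d₃ d₄ : Carrier) → Carrier
  det₄ a₁ a₂ a₃ a₄ b₁ b₂ b₃ b₄ c₁ c₂ c₃ c₄ d₁ d₂ d₃ d₄ =
    a₁ * det₃ b₂ b₃ b₄ c₂ c₃ c₄ d₂ d₃ d₄ + - (a₂ * det₃ b₁ b₃ b₄ c₁ c₃ c₄ d₁ d₃ d₄)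
    + a₃ * det₃ b₁ b₂ b₄ c₁ c₂ c₄ d₁ d₂ d₄ + - (a₄ * det₃ b₁ b₂ b₃ c₁ c₂ c₃ d₁ d₂ d₃)

  combination : (l₁ l₂ l₃ l₄ x₁ x₂ x₃ x₄ : Carrier) → Carrier
  combination l₁ l₂ l₃ l₄ x₁ x₂ x₃ x₄ = l₁ * x₁ + l₂ * x₂ + l₃ * x₃ + l₄ * x₄

  necklace : (A B C₀ C₁ x : Carrier) → Carrier
  necklace A B C₀ C₁ x = C₀ + x * (C₁ + - C₀) + x * (x + - 1#) * (A + B)

  expansion : (c₁ c₂ c₃ c₄ d₁ d₂ d₃ d₄ : Carrier) → Carrier
  expansion c₁ c₂ c₃ c₄ d₁ d₂ d₃ d₄ =
    (c₁ + c₂ + c₃ + c₄) * (d₁ + d₂ + d₃ + d₄)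
    + - (combination c₁ c₂ c₃ c₄ d₁ d₂ d₃ d₄ + combination c₁ c₂ c₃ c₄ d₁ d₂ d₃ d₄)

open import Data.Rational using (ℚ; mkℚ; 0ℚ; 1ℚ; _+_; _*_; -_; _-_; _/_; 1/_; NonZero; ≢-nonZero; toℚᵘ; +-*-rawRing)
open import Data.Rational.Properties
  using (*-inverseˡ; *-identityˡ; *-assoc; *-zeroˡ; ↥p/↧p≡p; toℚᵘ-injective; toℚᵘ-homo-+; toℚᵘ-homo-*; toℚᵘ-homo‿-)

open Polynomials +-*-rawRing

module ℚ-Solver = Data.Rational.Solver.+-*-Solver
module ℤ-Solver = Data.Integer.Solver.+-*-Solver

ℚ-syntax : ℕ → RawRing 0ℓ 0ℓ
ℚ-syntax n = record { Carrier = Polynomial n ; _≈_ = _≡_ ; _+_ = _:+_ ; _*_ = _:*_ ; -_ = :-_ ; 0# = con 0ℚ ; 1# = con 1ℚ }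
  where open ℚ-Solver

ℤ-syntax : ℕ → RawRing 0ℓ 0ℓ
ℤ-syntax n = record { Carrier = Polynomial n ; _≈_ = _≡_ ; _+_ = _:+_ ; _*_ = _:*_ ; -_ = :-_ ; 0# = con (+ 0) ; 1# = con (+ 1) }
  where open ℤ-Solver

eight : ℚ
eight = two + two + two + two

eight≢0 : eight ≢ 0ℚ
eight≢0 ()

*-cancelˡ : ∀ r {p q} → r ≢ 0ℚ → r * p ≡ r * q → p ≡ q
*-cancelˡ r {p} {q} r≢0 rp≡rq = begin
  p              ≡⟨ sym (*-identityˡ p) ⟩
  1ℚ * p         ≡⟨ cong (_* p) (sym (*-inverseˡ r)) ⟩
  1/ r * r * p   ≡⟨ *-assoc (1/ r) r p ⟩
  1/ r * (r * p) ≡⟨ cong (1/ r *_) rp≡rq ⟩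
  1/ r * (r * q) ≡⟨ sym (*-assoc (1/ r) r q) ⟩
  1/ r * r * q   ≡⟨ cong (_* q) (*-inverseˡ r) ⟩
  1ℚ * q         ≡⟨ *-identityˡ q ⟩
  q              ∎
  where
  open ≡-Reasoning
  instance _ : NonZero r
           _ = ≢-nonZero r≢0

combination-cong : ∀ l₁ l₂ l₃ l₄ {x₁ x₂ x₃ x₄ y₁ y₂ y₃ y₄} →
  x₁ ≡ y₁ → x₂ ≡ y₂ → x₃ ≡ y₃ → x₄ ≡ y₄ → combination l₁ l₂ l₃ l₄ x₁ x₂ x₃ x₄ ≡ combination l₁ l₂ l₃ l₄ y₁ y₂ y₃ y₄
combination-cong l₁ l₂ l₃ l₄ refl refl refl refl = refl

expansion-cong : ∀ {c₁ c₂ c₃ c₄ d₁ d₂ d₃ d₄ c₁′ c₂′ c₃′ c₄′ d₁′ d₂′ d₃′ d₄′} →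
  c₁ ≡ c₁′ → c₂ ≡ c₂′ → c₃ ≡ c₃′ → c₄ ≡ c₄′ → d₁ ≡ d₁′ → d₂ ≡ d₂′ → d₃ ≡ d₃′ → d₄ ≡ d₄′ →
  expansion c₁ c₂ c₃ c₄ d₁ d₂ d₃ d₄ ≡ expansion c₁′ c₂′ c₃′ c₄′ d₁′ d₂′ d₃′ d₄′
expansion-cong refl refl refl refl refl refl refl refl = refl

form2-sym : ∀ u v → form2 u v ≡ form2 v u
form2-sym u v = solve 9 (λ t a₁ a₂ a₃ a₄ b₁ b₂ b₃ b₄ →
    S.pairing t a₁ a₂ a₃ a₄ b₁ b₂ b₃ b₄ := S.pairing t b₁ b₂ b₃ b₄ a₁ a₂ a₃ a₄) refl
  two (bbar u) (curv u) (bx u) (by u) (bbar v) (curv v) (bx v) (by v)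
  where
  open ℚ-Solver
  module S = Polynomials (ℚ-syntax 9)

Tangent-sym : ∀ u v → Tangent u v → Tangent v u
Tangent-sym u v = trans (form2-sym v u)

det : Circle → Circle → Circle → Circle → ℚ
det p q r s = det₄ (bbar p) (curv p) (bx p) (by p) (bbar q) (curv q) (bx q) (by q)
                   (bbar r) (curv r) (bx r) (by r) (bbar s) (curv s) (bx s) (by s)

e₁ e₂ e₃ e₄ : Circle
e₁ = circle 1ℚ 0ℚ 0ℚ 0ℚ
e₂ = circle 0ℚ 1ℚ 0ℚ 0ℚ
e₃ = circle 0ℚ 0ℚ 1ℚ 0ℚ
e₄ = circle 0ℚ 0ℚ 0ℚ 1ℚ

form2-e₁ : ∀ u → form2 u e₁ ≡ curv u
form2-e₁ u = solve 5 (λ t b̄ b x y →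
    S.pairing t b̄ b x y (con 1ℚ) (con 0ℚ) (con 0ℚ) (con 0ℚ) := b) refl
  two (bbar u) (curv u) (bx u) (by u)
  where
  open ℚ-Solver
  module S = Polynomials (ℚ-syntax 5)

det-e≢0 : det e₁ e₂ e₃ e₄ ≢ 0ℚ
det-e≢0 ()

-- Cramer's rule, paired with w.
cramer : ∀ p q r s u w → det p q r s * form2 u w ≡
  combination (det u q r s) (det p u r s) (det p q u s) (det p q r u) (form2 p w) (form2 q w) (form2 r w) (form2 s w)
cramer p q r s u w =
  solve 25 (λ t a₁ a₂ a₃ a₄ b₁ b₂ b₃ b₄ c₁ c₂ c₃ c₄ d₁ d₂ d₃ d₄ u₁ u₂ u₃ u₄ w₁ w₂ w₃ w₄ →
    S.det₄ a₁ a₂ a₃ a₄ b₁ b₂ b₃ b₄ c₁ c₂ c₃ c₄ d₁ d₂ d₃ d₄ :* S.pairing t u₁ u₂ u₃ u₄ w₁ w₂ w₃ w₄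
    := S.combination
         (S.det₄ u₁ u₂ u₃ u₄ b₁ b₂ b₃ b₄ c₁ c₂ c₃ c₄ d₁ d₂ d₃ d₄) (S.det₄ a₁ a₂ a₃ a₄ u₁ u₂ u₃ u₄ c₁ c₂ c₃ c₄ d₁ d₂ d₃ d₄)
         (S.det₄ a₁ a₂ a₃ a₄ b₁ b₂ b₃ b₄ u₁ u₂ u₃ u₄ d₁ d₂ d₃ d₄) (S.det₄ a₁ a₂ a₃ a₄ b₁ b₂ b₃ b₄ c₁ c₂ c₃ c₄ u₁ u₂ u₃ u₄)
         (S.pairing t a₁ a₂ a₃ a₄ w₁ w₂ w₃ w₄) (S.pairing t b₁ b₂ b₃ b₄ w₁ w₂ w₃ w₄)
         (S.pairing t c₁ c₂ c₃ c₄ w₁ w₂ w₃ w₄) (S.pairing t d₁ d₂ d₃ d₄ w₁ w₂ w₃ w₄)) refl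
    two (bbar p) (curv p) (bx p) (by p) (bbar q) (curv q) (bx q) (by q)
    (bbar r) (curv r) (bx r) (by r) (bbar s) (curv s) (bx s) (by s)
    (bbar u) (curv u) (bx u) (by u) (bbar w) (curv w) (bx w) (by w)
  where
  open ℚ-Solver
  module S = Polynomials (ℚ-syntax 25)

record DescartesQuadruple (q₁ q₂ q₃ q₄ : Circle) : Set where
  field
    isCircle₁ : IsCircle q₁
    isCircle₂ : IsCircle q₂
    isCircle₃ : IsCircle q₃
    isCircle₄ : IsCircle q₄
    tangent₁₂ : Tangent q₁ q₂
    tangent₁₃ : Tangent q₁ q₃
    tangent₁₄ : Tangent q₁ q₄
    tangent₂₃ : Tangent q₂ q₃
    tangent₂₄ : Tangent q₂ q₄
    tangent₃₄ : Tangent q₃ q₄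

  tangent₂₁ : Tangent q₂ q₁
  tangent₂₁ = Tangent-sym q₁ q₂ tangent₁₂
  tangent₃₁ : Tangent q₃ q₁
  tangent₃₁ = Tangent-sym q₁ q₃ tangent₁₃
  tangent₄₁ : Tangent q₄ q₁
  tangent₄₁ = Tangent-sym q₁ q₄ tangent₁₄
  tangent₃₂ : Tangent q₃ q₂
  tangent₃₂ = Tangent-sym q₂ q₃ tangent₂₃
  tangent₄₂ : Tangent q₄ q₂
  tangent₄₂ = Tangent-sym q₂ q₄ tangent₂₄
  tangent₄₃ : Tangent q₄ q₃
  tangent₄₃ = Tangent-sym q₃ q₄ tangent₃₄

swap₁₂ : ∀ {a b c d} → DescartesQuadruple a b c d → DescartesQuadruple b a c d
swap₁₂ Q = record
  { isCircle₁ = isCircle₂ ; isCircle₂ = isCircle₁ ; isCircle₃ = isCircle₃ ; isCircle₄ = isCircle₄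
  ; tangent₁₂ = tangent₂₁ ; tangent₁₃ = tangent₂₃ ; tangent₁₄ = tangent₂₄
  ; tangent₂₃ = tangent₁₃ ; tangent₂₄ = tangent₁₄ ; tangent₃₄ = tangent₃₄ }
  where open DescartesQuadruple Q

swap₂₃ : ∀ {a b c d} → DescartesQuadruple a b c d → DescartesQuadruple a c b d
swap₂₃ Q = record
  { isCircle₁ = isCircle₁ ; isCircle₂ = isCircle₃ ; isCircle₃ = isCircle₂ ; isCircle₄ = isCircle₄
  ; tangent₁₂ = tangent₁₃ ; tangent₁₃ = tangent₁₂ ; tangent₁₄ = tangent₁₄
  ; tangent₂₃ = tangent₃₂ ; tangent₂₄ = tangent₃₄ ; tangent₃₄ = tangent₂₄ }
  where open DescartesQuadruple Q

swap₃₄ : ∀ {a b c d} → DescartesQuadruple a b c d → DescartesQuadruple a b d c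
swap₃₄ Q = record
  { isCircle₁ = isCircle₁ ; isCircle₂ = isCircle₂ ; isCircle₃ = isCircle₄ ; isCircle₄ = isCircle₃
  ; tangent₁₂ = tangent₁₂ ; tangent₁₃ = tangent₁₄ ; tangent₁₄ = tangent₁₃
  ; tangent₂₃ = tangent₂₄ ; tangent₂₄ = tangent₂₃ ; tangent₃₄ = tangent₄₃ }
  where open DescartesQuadruple Q

rotate-last : ∀ {a b c w} → DescartesQuadruple a b c w → DescartesQuadruple w a b c
rotate-last Q = swap₁₂ (swap₂₃ (swap₃₄ Q))

module _ {q₁ q₂ q₃ q₄} (Q : DescartesQuadruple q₁ q₂ q₃ q₄) where
  open DescartesQuadruple Q

  -- The Gram matrix of q₁, …, q₄ is 2J − 4I, whose kernel is trivial:
  -- 8 lⱼ is the sum of the other three rows minus row j.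
  gram-independent : ∀ l₁ l₂ l₃ l₄ →
    (∀ w → combination l₁ l₂ l₃ l₄ (form2 q₁ w) (form2 q₂ w) (form2 q₃ w) (form2 q₄ w) ≡ 0ℚ) →
    l₁ ≡ 0ℚ × l₂ ≡ 0ℚ × l₃ ≡ 0ℚ × l₄ ≡ 0ℚ
  gram-independent l₁ l₂ l₃ l₄ h =
      eight-times-vanishing (kernel₁ two l₁ l₂ l₃ l₄) row₂ row₃ row₄ row₁
    , eight-times-vanishing (kernel₂ two l₁ l₂ l₃ l₄) row₁ row₃ row₄ row₂
    , eight-times-vanishing (kernel₃ two l₁ l₂ l₃ l₄) row₁ row₂ row₄ row₃
    , eight-times-vanishing (kernel₄ two l₁ l₂ l₃ l₄) row₁ row₂ row₃ row₄
    where
    eight-times-vanishing : ∀ {l x₁ x₂ x₃ x₄} → eight * l ≡ x₁ + x₂ + x₃ + - x₄ →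
      x₁ ≡ 0ℚ → x₂ ≡ 0ℚ → x₃ ≡ 0ℚ → x₄ ≡ 0ℚ → l ≡ 0ℚ
    eight-times-vanishing e refl refl refl refl = *-cancelˡ eight eight≢0 e
    row₁ : combination l₁ l₂ l₃ l₄ (- two) two two two ≡ 0ℚ
    row₁ = trans (sym (combination-cong l₁ l₂ l₃ l₄ isCircle₁ tangent₂₁ tangent₃₁ tangent₄₁)) (h q₁)
    row₂ : combination l₁ l₂ l₃ l₄ two (- two) two two ≡ 0ℚ
    row₂ = trans (sym (combination-cong l₁ l₂ l₃ l₄ tangent₁₂ isCircle₂ tangent₃₂ tangent₄₂)) (h q₂)
    row₃ : combination l₁ l₂ l₃ l₄ two two (- two) two ≡ 0ℚ
    row₃ = trans (sym (combination-cong l₁ l₂ l₃ l₄ tangent₁₃ tangent₂₃ isCircle₃ tangent₄₃)) (h q₃)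
    row₄ : combination l₁ l₂ l₃ l₄ two two two (- two) ≡ 0ℚ
    row₄ = trans (sym (combination-cong l₁ l₂ l₃ l₄ tangent₁₄ tangent₂₄ tangent₃₄ isCircle₄)) (h q₄)
    open ℚ-Solver
    module S = Polynomials (ℚ-syntax 5)
    kernel₁ : ∀ t l₁ l₂ l₃ l₄ → (t + t + t + t) * l₁ ≡ combination l₁ l₂ l₃ l₄ t (- t) t t
      + combination l₁ l₂ l₃ l₄ t t (- t) t + combination l₁ l₂ l₃ l₄ t t t (- t) + - combination l₁ l₂ l₃ l₄ (- t) t t t
    kernel₁ = solve 5 (λ t l₁ l₂ l₃ l₄ → (t :+ t :+ t :+ t) :* l₁ := S.combination l₁ l₂ l₃ l₄ t (:- t) t t
      :+ S.combination l₁ l₂ l₃ l₄ t t (:- t) t :+ S.combination l₁ l₂ l₃ l₄ t t t (:- t) :+ :- S.combination l₁ l₂ l₃ l₄ (:- t) t t t) refl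
    kernel₂ : ∀ t l₁ l₂ l₃ l₄ → (t + t + t + t) * l₂ ≡ combination l₁ l₂ l₃ l₄ (- t) t t t
      + combination l₁ l₂ l₃ l₄ t t (- t) t + combination l₁ l₂ l₃ l₄ t t t (- t) + - combination l₁ l₂ l₃ l₄ t (- t) t t
    kernel₂ = solve 5 (λ t l₁ l₂ l₃ l₄ → (t :+ t :+ t :+ t) :* l₂ := S.combination l₁ l₂ l₃ l₄ (:- t) t t t
      :+ S.combination l₁ l₂ l₃ l₄ t t (:- t) t :+ S.combination l₁ l₂ l₃ l₄ t t t (:- t) :+ :- S.combination l₁ l₂ l₃ l₄ t (:- t) t t) refl
    kernel₃ : ∀ t l₁ l₂ l₃ l₄ → (t + t + t + t) * l₃ ≡ combination l₁ l₂ l₃ l₄ (- t) t t t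
      + combination l₁ l₂ l₃ l₄ t (- t) t t + combination l₁ l₂ l₃ l₄ t t t (- t) + - combination l₁ l₂ l₃ l₄ t t (- t) t
    kernel₃ = solve 5 (λ t l₁ l₂ l₃ l₄ → (t :+ t :+ t :+ t) :* l₃ := S.combination l₁ l₂ l₃ l₄ (:- t) t t t
      :+ S.combination l₁ l₂ l₃ l₄ t (:- t) t t :+ S.combination l₁ l₂ l₃ l₄ t t t (:- t) :+ :- S.combination l₁ l₂ l₃ l₄ t t (:- t) t) refl
    kernel₄ : ∀ t l₁ l₂ l₃ l₄ → (t + t + t + t) * l₄ ≡ combination l₁ l₂ l₃ l₄ (- t) t t t
      + combination l₁ l₂ l₃ l₄ t (- t) t t + combination l₁ l₂ l₃ l₄ t t (- t) t + - combination l₁ l₂ l₃ l₄ t t t (- t)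
    kernel₄ = solve 5 (λ t l₁ l₂ l₃ l₄ → (t :+ t :+ t :+ t) :* l₄ := S.combination l₁ l₂ l₃ l₄ (:- t) t t t
      :+ S.combination l₁ l₂ l₃ l₄ t (:- t) t t :+ S.combination l₁ l₂ l₃ l₄ t t (:- t) t :+ :- S.combination l₁ l₂ l₃ l₄ t t t (:- t)) refl

  -- If det vanished, Cramer's rule and independence would make det vanish after
  -- replacing q₁, then q₂, q₃, q₄ by arbitrary vectors; but det e₁ e₂ e₃ e₄ = 1.
  det≢0 : det q₁ q₂ q₃ q₄ ≢ 0ℚ
  det≢0 Δ≡0 = det-e≢0 (vanish₄ e₁ e₂ e₃ e₄)
    where
    vanishing-term : ∀ {a} x y → a ≡ 0ℚ → a * x ≡ 0ℚ * y
    vanishing-term x y refl = trans (*-zeroˡ x) (sym (*-zeroˡ y))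

    cramer-singular : ∀ p q r s → det p q r s ≡ 0ℚ → ∀ u w →
      combination (det u q r s) (det p u r s) (det p q u s) (det p q r u) (form2 p w) (form2 q w) (form2 r w) (form2 s w) ≡ 0ℚ
    cramer-singular p q r s Δ u w = trans (sym (cramer p q r s u w)) (trans (cong (_* form2 u w) Δ) (*-zeroˡ (form2 u w)))

    vanish₁ : ∀ u → det u q₂ q₃ q₄ ≡ 0ℚ
    vanish₁ u = proj₁ (gram-independent (det u q₂ q₃ q₄) (det q₁ u q₃ q₄) (det q₁ q₂ u q₄) (det q₁ q₂ q₃ u)
      (cramer-singular q₁ q₂ q₃ q₄ Δ≡0 u))

    vanish₂ : ∀ t u → det t u q₃ q₄ ≡ 0ℚ
    vanish₂ t u = proj₁ (proj₂ (gram-independent 0ℚ (det t u q₃ q₄) (det t q₂ u q₄) (det t q₂ q₃ u) λ w →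
      trans (cong (λ z → z + det t u q₃ q₄ * form2 q₂ w + det t q₂ u q₄ * form2 q₃ w + det t q₂ q₃ u * form2 q₄ w)
                  (sym (vanishing-term (form2 t w) (form2 q₁ w) (vanish₁ u))))
            (cramer-singular t q₂ q₃ q₄ (vanish₁ t) u w)))

    vanish₃ : ∀ t s u → det t s u q₄ ≡ 0ℚ
    vanish₃ t s u = proj₁ (proj₂ (proj₂ (gram-independent 0ℚ 0ℚ (det t s u q₄) (det t s q₃ u) λ w →
      trans (cong (λ z → z + det t s u q₄ * form2 q₃ w + det t s q₃ u * form2 q₄ w)
                  (sym (cong₂ _+_ (vanishing-term (form2 t w) (form2 q₁ w) (vanish₂ u s))
                                  (vanishing-term (form2 s w) (form2 q₂ w) (vanish₂ t u)))))
            (cramer-singular t s q₃ q₄ (vanish₂ t s) u w))))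

    vanish₄ : ∀ t s r u → det t s r u ≡ 0ℚ
    vanish₄ t s r u = proj₂ (proj₂ (proj₂ (gram-independent 0ℚ 0ℚ 0ℚ (det t s r u) λ w →
      trans (cong (_+ det t s r u * form2 q₄ w)
                  (sym (cong₂ _+_ (cong₂ _+_ (vanishing-term (form2 t w) (form2 q₁ w) (vanish₃ u s r))
                                             (vanishing-term (form2 s w) (form2 q₂ w) (vanish₃ t u r)))
                                  (vanishing-term (form2 r w) (form2 q₃ w) (vanish₃ t s u)))))
            (cramer-singular t s r q₄ (vanish₃ t s r) u w))))

  -- Expanding u and v in the basis q₁, …, q₄ (inverse Gram matrix (J − 2I)/8).
  gram-expansion : ∀ u v → eight * form2 u v ≡
    expansion (form2 u q₁) (form2 u q₂) (form2 u q₃) (form2 u q₄) (form2 q₁ v) (form2 q₂ v) (form2 q₃ v) (form2 q₄ v)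
  gram-expansion u v = *-cancelˡ Δ det≢0 (begin
    Δ * (eight * form2 u v)                  ≡⟨ reorder two Δ (form2 u v) ⟩
    eight * (Δ * form2 u v)                  ≡⟨ cong (eight *_) (cramer q₁ q₂ q₃ q₄ u v) ⟩
    eight * combination g₁ g₂ g₃ g₄ d₁ d₂ d₃ d₄
      ≡⟨ by-columns two g₁ g₂ g₃ g₄ d₁ d₂ d₃ d₄ ⟩
    expansion (combination g₁ g₂ g₃ g₄ (- two) two two two) (combination g₁ g₂ g₃ g₄ two (- two) two two)
              (combination g₁ g₂ g₃ g₄ two two (- two) two) (combination g₁ g₂ g₃ g₄ two two two (- two)) d₁ d₂ d₃ d₄
      ≡⟨ sym (expansion-cong
           (column q₁ isCircle₁ tangent₂₁ tangent₃₁ tangent₄₁) (column q₂ tangent₁₂ isCircle₂ tangent₃₂ tangent₄₂)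
           (column q₃ tangent₁₃ tangent₂₃ isCircle₃ tangent₄₃) (column q₄ tangent₁₄ tangent₂₄ tangent₃₄ isCircle₄)
           refl refl refl refl) ⟩
    expansion (Δ * form2 u q₁) (Δ * form2 u q₂) (Δ * form2 u q₃) (Δ * form2 u q₄) d₁ d₂ d₃ d₄
      ≡⟨ scale Δ (form2 u q₁) (form2 u q₂) (form2 u q₃) (form2 u q₄) d₁ d₂ d₃ d₄ ⟩
    Δ * expansion (form2 u q₁) (form2 u q₂) (form2 u q₃) (form2 u q₄) d₁ d₂ d₃ d₄ ∎)
    where
    open ≡-Reasoning
    Δ = det q₁ q₂ q₃ q₄
    g₁ = det u q₂ q₃ q₄
    g₂ = det q₁ u q₃ q₄
    g₃ = det q₁ q₂ u q₄
    g₄ = det q₁ q₂ q₃ u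
    d₁ = form2 q₁ v
    d₂ = form2 q₂ v
    d₃ = form2 q₃ v
    d₄ = form2 q₄ v
    column : ∀ w {x₁ x₂ x₃ x₄} → form2 q₁ w ≡ x₁ → form2 q₂ w ≡ x₂ → form2 q₃ w ≡ x₃ → form2 q₄ w ≡ x₄ →
      Δ * form2 u w ≡ combination g₁ g₂ g₃ g₄ x₁ x₂ x₃ x₄
    column w h₁ h₂ h₃ h₄ = trans (cramer q₁ q₂ q₃ q₄ u w) (combination-cong g₁ g₂ g₃ g₄ h₁ h₂ h₃ h₄)
    open ℚ-Solver
    module S = Polynomials (ℚ-syntax 9)
    reorder : ∀ t a b → a * ((t + t + t + t) * b) ≡ (t + t + t + t) * (a * b)
    reorder = solve 3 (λ t a b → a :* ((t :+ t :+ t :+ t) :* b) := (t :+ t :+ t :+ t) :* (a :* b)) refl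
    by-columns : ∀ t g₁ g₂ g₃ g₄ d₁ d₂ d₃ d₄ → (t + t + t + t) * combination g₁ g₂ g₃ g₄ d₁ d₂ d₃ d₄ ≡
      expansion (combination g₁ g₂ g₃ g₄ (- t) t t t) (combination g₁ g₂ g₃ g₄ t (- t) t t)
                (combination g₁ g₂ g₃ g₄ t t (- t) t) (combination g₁ g₂ g₃ g₄ t t t (- t)) d₁ d₂ d₃ d₄
    by-columns = solve 9 (λ t g₁ g₂ g₃ g₄ d₁ d₂ d₃ d₄ → (t :+ t :+ t :+ t) :* S.combination g₁ g₂ g₃ g₄ d₁ d₂ d₃ d₄ :=
      S.expansion (S.combination g₁ g₂ g₃ g₄ (:- t) t t t) (S.combination g₁ g₂ g₃ g₄ t (:- t) t t)
                  (S.combination g₁ g₂ g₃ g₄ t t (:- t) t) (S.combination g₁ g₂ g₃ g₄ t t t (:- t)) d₁ d₂ d₃ d₄) refl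
    scale : ∀ a c₁ c₂ c₃ c₄ d₁ d₂ d₃ d₄ →
      expansion (a * c₁) (a * c₂) (a * c₃) (a * c₄) d₁ d₂ d₃ d₄ ≡ a * expansion c₁ c₂ c₃ c₄ d₁ d₂ d₃ d₄
    scale = solve 9 (λ a c₁ c₂ c₃ c₄ d₁ d₂ d₃ d₄ →
      S.expansion (a :* c₁) (a :* c₂) (a :* c₃) (a :* c₄) d₁ d₂ d₃ d₄ := a :* S.expansion c₁ c₂ c₃ c₄ d₁ d₂ d₃ d₄) refl

combinationℤ : (l₁ l₂ l₃ l₄ x₁ x₂ x₃ x₄ : ℤ) → ℤ
combinationℤ = Polynomials.combination ℤ.+-*-rawRing

expansionℤ : (c₁ c₂ c₃ c₄ d₁ d₂ d₃ d₄ : ℤ) → ℤ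
expansionℤ = Polynomials.expansion ℤ.+-*-rawRing

-- Opaque, so that the normalisation hidden in z / 1 is never unfolded by the type checker.
opaque
  fromℤ : ℤ → ℚ
  fromℤ z = z / 1

opaque
  unfolding fromℤ

  fromℤ≡/1 : ∀ z → fromℤ z ≡ z / 1
  fromℤ≡/1 z = refl

  private
    coprime-1 : ∀ z → Coprime ℤ.∣ z ∣ 1
    coprime-1 z = Coprimality.sym (Coprimality.1-coprimeTo ℤ.∣ z ∣)

    fromℤ≡mkℚ : ∀ z → fromℤ z ≡ mkℚ z 0 (coprime-1 z)
    fromℤ≡mkℚ z = ↥p/↧p≡p (mkℚ z 0 (coprime-1 z))

  fromℤ-+ : ∀ a b → fromℤ (a ℤ.+ b) ≡ fromℤ a + fromℤ b
  fromℤ-+ a b rewrite fromℤ≡mkℚ a | fromℤ≡mkℚ b | fromℤ≡mkℚ (a ℤ.+ b) =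
    toℚᵘ-injective (ℚᵘ.≃-sym (ℚᵘ.≃-trans (toℚᵘ-homo-+ (mkℚ a 0 (coprime-1 a)) (mkℚ b 0 (coprime-1 b))) (ℚᵘ.*≡* cross)))
    where
    cross : (a ℤ.* + 1 ℤ.+ b ℤ.* + 1) ℤ.* + 1 ≡ (a ℤ.+ b) ℤ.* (+ 1 ℤ.* + 1)
    cross rewrite ℤ.*-identityʳ a | ℤ.*-identityʳ b | ℤ.*-identityʳ (a ℤ.+ b) = refl

  fromℤ-* : ∀ a b → fromℤ (a ℤ.* b) ≡ fromℤ a * fromℤ b
  fromℤ-* a b = sym (cong₂ _*_ (fromℤ≡mkℚ a) (fromℤ≡mkℚ b))

  fromℤ-neg : ∀ a → fromℤ (ℤ.- a) ≡ - fromℤ a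
  fromℤ-neg a rewrite fromℤ≡mkℚ a | fromℤ≡mkℚ (ℤ.- a) =
    toℚᵘ-injective (ℚᵘ.≃-sym (ℚᵘ.≃-trans (toℚᵘ-homo‿- (mkℚ a 0 (coprime-1 a))) (ℚᵘ.*≡* refl)))

  fromℤ-injective : ∀ {a b} → fromℤ a ≡ fromℤ b → a ≡ b
  fromℤ-injective {a} {b} e with trans (sym (fromℤ≡mkℚ a)) (trans e (fromℤ≡mkℚ b))
  ... | refl = refl

  fromℤ-0 : fromℤ (+ 0) ≡ 0ℚ
  fromℤ-0 = refl

  fromℤ-2 : fromℤ (+ 2) ≡ two
  fromℤ-2 = refl

  fromℤ-[-2] : fromℤ -[1+ 1 ] ≡ - two
  fromℤ-[-2] = refl

  fromℤ-8 : fromℤ (+ 8) ≡ eight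
  fromℤ-8 = refl

  -- If (n/D)² = N with n coprime to D, then D divides n² = N D², hence n, so D = 1.
  square-integral⇒integral : ∀ q N → q * q ≡ fromℤ N → ∃ λ m → q ≡ fromℤ m
  square-integral⇒integral q@(mkℚ n d coprime) N q²≡N = n , trans q≡n/1 (sym (fromℤ≡mkℚ n))
    where
    open ≡-Reasoning
    D : ℕ
    D = suc d
    cross : n ℤ.* n ℤ.* + 1 ≡ N ℤ.* + (D ℕ.* D)
    cross with ℚᵘ.≃-trans (ℚᵘ.≃-sym (toℚᵘ-homo-* q q)) (ℚᵘ.≃-reflexive (cong toℚᵘ (trans q²≡N (fromℤ≡mkℚ N))))
    ... | ℚᵘ.*≡* e = e
    n²≡ND² : ℤ.∣ n ∣ ℕ.* ℤ.∣ n ∣ ≡ ℤ.∣ N ∣ ℕ.* D ℕ.* D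
    n²≡ND² = begin
      ℤ.∣ n ∣ ℕ.* ℤ.∣ n ∣          ≡⟨ sym (ℤ.abs-* n n) ⟩
      ℤ.∣ n ℤ.* n ∣                ≡⟨ cong ℤ.∣_∣ (sym (ℤ.*-identityʳ (n ℤ.* n))) ⟩
      ℤ.∣ n ℤ.* n ℤ.* + 1 ∣        ≡⟨ cong ℤ.∣_∣ cross ⟩
      ℤ.∣ N ℤ.* + (D ℕ.* D) ∣      ≡⟨ ℤ.abs-* N (+ (D ℕ.* D)) ⟩
      ℤ.∣ N ∣ ℕ.* (D ℕ.* D)        ≡⟨ sym (ℕ.*-assoc ℤ.∣ N ∣ D D) ⟩
      ℤ.∣ N ∣ ℕ.* D ℕ.* D          ∎
    D∣n : D ℕ.∣ ℤ.∣ n ∣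
    D∣n = Coprimality.coprime-divisor (Coprimality.sym (Coprimality.recompute coprime)) (ℕ.divides (ℤ.∣ N ∣ ℕ.* D) n²≡ND²)
    q≡n/1 : mkℚ n d coprime ≡ mkℚ n 0 (coprime-1 n)
    q≡n/1 with Coprimality.recompute coprime (D∣n , ℕ.∣-refl)
    ... | refl = refl

fromℤ-sum : ∀ a b c d → fromℤ (a ℤ.+ b ℤ.+ c ℤ.+ d) ≡ fromℤ a + fromℤ b + fromℤ c + fromℤ d
fromℤ-sum a b c d = trans (fromℤ-+ (a ℤ.+ b ℤ.+ c) d) (cong (_+ fromℤ d)
  (trans (fromℤ-+ (a ℤ.+ b) c) (cong (_+ fromℤ c) (fromℤ-+ a b))))

fromℤ-combination : ∀ l₁ l₂ l₃ l₄ x₁ x₂ x₃ x₄ →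
  fromℤ (combinationℤ l₁ l₂ l₃ l₄ x₁ x₂ x₃ x₄) ≡
  combination (fromℤ l₁) (fromℤ l₂) (fromℤ l₃) (fromℤ l₄) (fromℤ x₁) (fromℤ x₂) (fromℤ x₃) (fromℤ x₄)
fromℤ-combination l₁ l₂ l₃ l₄ x₁ x₂ x₃ x₄ =
  trans (fromℤ-sum (l₁ ℤ.* x₁) (l₂ ℤ.* x₂) (l₃ ℤ.* x₃) (l₄ ℤ.* x₄))
        (cong₂ _+_ (cong₂ _+_ (cong₂ _+_ (fromℤ-* l₁ x₁) (fromℤ-* l₂ x₂)) (fromℤ-* l₃ x₃)) (fromℤ-* l₄ x₄))

fromℤ-expansion : ∀ c₁ c₂ c₃ c₄ d₁ d₂ d₃ d₄ → fromℤ (expansionℤ c₁ c₂ c₃ c₄ d₁ d₂ d₃ d₄) ≡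
  expansion (fromℤ c₁) (fromℤ c₂) (fromℤ c₃) (fromℤ c₄) (fromℤ d₁) (fromℤ d₂) (fromℤ d₃) (fromℤ d₄)
fromℤ-expansion c₁ c₂ c₃ c₄ d₁ d₂ d₃ d₄ = begin
  fromℤ (s ℤ.* t ℤ.+ ℤ.- (k ℤ.+ k))          ≡⟨ fromℤ-+ (s ℤ.* t) (ℤ.- (k ℤ.+ k)) ⟩
  fromℤ (s ℤ.* t) + fromℤ (ℤ.- (k ℤ.+ k))    ≡⟨ cong₂ _+_ (fromℤ-* s t) (trans (fromℤ-neg (k ℤ.+ k)) (cong -_ (fromℤ-+ k k))) ⟩
  fromℤ s * fromℤ t + - (fromℤ k + fromℤ k)  ≡⟨ cong₂ (λ x y → x + - (y + y))
                                                  (cong₂ _*_ (fromℤ-sum c₁ c₂ c₃ c₄) (fromℤ-sum d₁ d₂ d₃ d₄))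
                                                  (fromℤ-combination c₁ c₂ c₃ c₄ d₁ d₂ d₃ d₄) ⟩
  expansion (fromℤ c₁) (fromℤ c₂) (fromℤ c₃) (fromℤ c₄) (fromℤ d₁) (fromℤ d₂) (fromℤ d₃) (fromℤ d₄) ∎
  where
  open ≡-Reasoning
  s = c₁ ℤ.+ c₂ ℤ.+ c₃ ℤ.+ c₄
  t = d₁ ℤ.+ d₂ ℤ.+ d₃ ℤ.+ d₄
  k = combinationℤ c₁ c₂ c₃ c₄ d₁ d₂ d₃ d₄

form2-e₁ˡ : ∀ u → form2 e₁ u ≡ curv u
form2-e₁ˡ u = trans (form2-sym e₁ u) (form2-e₁ u)

module _ {q₁ q₂ q₃ q₄} (Q : DescartesQuadruple q₁ q₂ q₃ q₄) where

  gram-expansionℤ : ∀ u v {c₁ c₂ c₃ c₄ d₁ d₂ d₃ d₄ f} →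
    form2 u q₁ ≡ fromℤ c₁ → form2 u q₂ ≡ fromℤ c₂ → form2 u q₃ ≡ fromℤ c₃ → form2 u q₄ ≡ fromℤ c₄ →
    form2 q₁ v ≡ fromℤ d₁ → form2 q₂ v ≡ fromℤ d₂ → form2 q₃ v ≡ fromℤ d₃ → form2 q₄ v ≡ fromℤ d₄ →
    form2 u v ≡ fromℤ f → + 8 ℤ.* f ≡ expansionℤ c₁ c₂ c₃ c₄ d₁ d₂ d₃ d₄
  gram-expansionℤ u v {c₁} {c₂} {c₃} {c₄} {d₁} {d₂} {d₃} {d₄} {f} h₁ h₂ h₃ h₄ k₁ k₂ k₃ k₄ hf = fromℤ-injective (begin
    fromℤ (+ 8 ℤ.* f)                  ≡⟨ fromℤ-* (+ 8) f ⟩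
    fromℤ (+ 8) * fromℤ f              ≡⟨ cong₂ _*_ fromℤ-8 (sym hf) ⟩
    eight * form2 u v                  ≡⟨ gram-expansion Q u v ⟩
    expansion (form2 u q₁) (form2 u q₂) (form2 u q₃) (form2 u q₄) (form2 q₁ v) (form2 q₂ v) (form2 q₃ v) (form2 q₄ v)
                                       ≡⟨ expansion-cong h₁ h₂ h₃ h₄ k₁ k₂ k₃ k₄ ⟩
    expansion (fromℤ c₁) (fromℤ c₂) (fromℤ c₃) (fromℤ c₄) (fromℤ d₁) (fromℤ d₂) (fromℤ d₃) (fromℤ d₄)
                                       ≡⟨ sym (fromℤ-expansion c₁ c₂ c₃ c₄ d₁ d₂ d₃ d₄) ⟩
    fromℤ (expansionℤ c₁ c₂ c₃ c₄ d₁ d₂ d₃ d₄) ∎)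
    where open ≡-Reasoning

  -- (b₁ + b₂ + b₃ + b₄)² = 2 (b₁² + b₂² + b₃² + b₄²): pair with e₁, on which form2 is the curvature.
  descartes-relation : ∀ {b₁ b₂ b₃ b₄} → curv q₁ ≡ fromℤ b₁ → curv q₂ ≡ fromℤ b₂ → curv q₃ ≡ fromℤ b₃ → curv q₄ ≡ fromℤ b₄ →
    expansionℤ b₁ b₂ b₃ b₄ b₁ b₂ b₃ b₄ ≡ + 0
  descartes-relation h₁ h₂ h₃ h₄ = sym (gram-expansionℤ e₁ e₁
    (trans (form2-e₁ˡ q₁) h₁) (trans (form2-e₁ˡ q₂) h₂) (trans (form2-e₁ˡ q₃) h₃) (trans (form2-e₁ˡ q₄) h₄)
    (trans (form2-e₁ q₁) h₁) (trans (form2-e₁ q₂) h₂) (trans (form2-e₁ q₃) h₃) (trans (form2-e₁ q₄) h₄)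
    (sym fromℤ-0))

parity : ∀ m → ∃ λ d → m ≡ + 2 ℤ.* d ⊎ m ≡ + 1 ℤ.+ + 2 ℤ.* d
parity m with m ℤ.% + 2 | ℤ.n%d<d m (+ 2) | ℤ.a≡a%n+[a/n]*n m (+ 2)
... | 0           | _                 | e = m ℤ./ + 2 , inj₁ (trans e (even (m ℤ./ + 2)))
  where
  even : ∀ x → + 0 ℤ.+ x ℤ.* + 2 ≡ + 2 ℤ.* x
  even = solve-∀
... | 1           | _                 | e = m ℤ./ + 2 , inj₂ (trans e (odd (m ℤ./ + 2)))
  where
  odd : ∀ x → + 1 ℤ.+ x ℤ.* + 2 ≡ + 1 ℤ.+ + 2 ℤ.* x
  odd = solve-∀
... | suc (suc _) | s≤s (s≤s ()) | _

odd≢even : ∀ x y → + 1 ℤ.+ + 2 ℤ.* x ≢ + 2 ℤ.* y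
odd≢even x y e with ℕ.∣1⇒≡1 (ℕ.divides ℤ.∣ y ℤ.- x ∣ (begin
    1                           ≡⟨ cong ℤ.∣_∣ 1≡2[y-x] ⟩
    ℤ.∣ + 2 ℤ.* (y ℤ.- x) ∣     ≡⟨ ℤ.abs-* (+ 2) (y ℤ.- x) ⟩
    2 ℕ.* ℤ.∣ y ℤ.- x ∣         ≡⟨ ℕ.*-comm 2 ℤ.∣ y ℤ.- x ∣ ⟩
    ℤ.∣ y ℤ.- x ∣ ℕ.* 2         ∎))
  where
  open ≡-Reasoning
  cancel : ∀ x → + 1 ≡ + 1 ℤ.+ + 2 ℤ.* x ℤ.- + 2 ℤ.* x
  cancel = solve-∀
  distrib : ∀ x y → + 2 ℤ.* y ℤ.- + 2 ℤ.* x ≡ + 2 ℤ.* (y ℤ.- x)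
  distrib = solve-∀
  1≡2[y-x] : + 1 ≡ + 2 ℤ.* (y ℤ.- x)
  1≡2[y-x] = trans (cancel x) (trans (cong (ℤ._- + 2 ℤ.* x) e) (distrib x y))
... | ()

even-square⇒even : ∀ m j → m ℤ.* m ≡ + 2 ℤ.* j → ∃ λ h → m ≡ + 2 ℤ.* h
even-square⇒even m j e with parity m
... | h , inj₁ m≡2h = h , m≡2h
... | h , inj₂ m≡1+2h = ⊥-elim (odd≢even (h ℤ.+ h ℤ.+ h ℤ.* h ℤ.+ h ℤ.* h) j (trans (sym (square h))
        (trans (cong (λ z → z ℤ.* z) (sym m≡1+2h)) e)))
  where
  square : ∀ h → (+ 1 ℤ.+ + 2 ℤ.* h) ℤ.* (+ 1 ℤ.+ + 2 ℤ.* h) ≡ + 1 ℤ.+ + 2 ℤ.* (h ℤ.+ h ℤ.+ h ℤ.* h ℤ.+ h ℤ.* h)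
  square = solve-∀

twiceOdd : ℤ → ℤ
twiceOdd k = + 2 ℤ.* (+ 1 ℤ.+ + 2 ℤ.* k)

TwiceOdd : ℚ → Set
TwiceOdd x = ∃ λ k → x ≡ fromℤ (twiceOdd k)

-- With pᵢ = 2aᵢ, aᵢ odd, and s = p₁ + p₂ + p₃, the right-hand side is 8 (A² − Σ aᵢ² + 2)
-- with A = Σ aᵢ; so 4 divides m, and m + s = 4g + 2A is twice an odd number.
twiceOdd-square-root : ∀ k₁ k₂ k₃ m → let p₁ = twiceOdd k₁ ; p₂ = twiceOdd k₂ ; p₃ = twiceOdd k₃ ; s = p₁ ℤ.+ p₂ ℤ.+ p₃ in
  m ℤ.* m ≡ expansionℤ p₁ p₂ p₃ s p₁ p₂ p₃ s ℤ.- + 8 ℤ.* -[1+ 1 ] → ∃ λ k → m ℤ.+ s ≡ twiceOdd k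
twiceOdd-square-root k₁ k₂ k₃ m m²≡ = + 1 ℤ.+ k₁ ℤ.+ k₂ ℤ.+ k₃ ℤ.+ g , (begin
    m ℤ.+ s                    ≡⟨ cong (ℤ._+ s) (trans m≡2h (cong (+ 2 ℤ.*_) h≡2g)) ⟩
    + 2 ℤ.* (+ 2 ℤ.* g) ℤ.+ s  ≡⟨ regroup k₁ k₂ k₃ g ⟩
    twiceOdd (+ 1 ℤ.+ k₁ ℤ.+ k₂ ℤ.+ k₃ ℤ.+ g) ∎)
  where
  open ≡-Reasoning
  p₁ = twiceOdd k₁
  p₂ = twiceOdd k₂
  p₃ = twiceOdd k₃
  s = p₁ ℤ.+ p₂ ℤ.+ p₃
  a₁ = + 1 ℤ.+ + 2 ℤ.* k₁
  a₂ = + 1 ℤ.+ + 2 ℤ.* k₂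
  a₃ = + 1 ℤ.+ + 2 ℤ.* k₃
  R = (a₁ ℤ.+ a₂ ℤ.+ a₃) ℤ.* (a₁ ℤ.+ a₂ ℤ.+ a₃) ℤ.- (a₁ ℤ.* a₁ ℤ.+ a₂ ℤ.* a₂ ℤ.+ a₃ ℤ.* a₃) ℤ.+ + 2
  eightfold : expansionℤ p₁ p₂ p₃ s p₁ p₂ p₃ s ℤ.- + 8 ℤ.* -[1+ 1 ] ≡ + 2 ℤ.* (+ 4 ℤ.* R)
  eightfold = solve 3 (λ k₁ k₂ k₃ →
      let A₁ = con (+ 1) :+ con (+ 2) :* k₁ ; A₂ = con (+ 1) :+ con (+ 2) :* k₂ ; A₃ = con (+ 1) :+ con (+ 2) :* k₃
          P₁ = con (+ 2) :* A₁ ; P₂ = con (+ 2) :* A₂ ; P₃ = con (+ 2) :* A₃ ; S = P₁ :+ P₂ :+ P₃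
      in E.expansion P₁ P₂ P₃ S P₁ P₂ P₃ S :- con (+ 8) :* con -[1+ 1 ]
         := con (+ 2) :* (con (+ 4) :* ((A₁ :+ A₂ :+ A₃) :* (A₁ :+ A₂ :+ A₃) :- (A₁ :* A₁ :+ A₂ :* A₂ :+ A₃ :* A₃) :+ con (+ 2))))
    refl k₁ k₂ k₃
    where
    open ℤ-Solver
    module E = Polynomials (ℤ-syntax 3)
  h = proj₁ (even-square⇒even m (+ 4 ℤ.* R) (trans m²≡ eightfold))
  m≡2h = proj₂ (even-square⇒even m (+ 4 ℤ.* R) (trans m²≡ eightfold))
  h²≡2R : h ℤ.* h ≡ + 2 ℤ.* R
  h²≡2R = ℤ.*-cancelˡ-≡ (+ 4) (h ℤ.* h) (+ 2 ℤ.* R) (begin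
    + 4 ℤ.* (h ℤ.* h)            ≡⟨ square-double h ⟩
    (+ 2 ℤ.* h) ℤ.* (+ 2 ℤ.* h)  ≡⟨ cong (λ z → z ℤ.* z) (sym m≡2h) ⟩
    m ℤ.* m                      ≡⟨ trans m²≡ eightfold ⟩
    + 2 ℤ.* (+ 4 ℤ.* R)          ≡⟨ swap-factors R ⟩
    + 4 ℤ.* (+ 2 ℤ.* R)          ∎)
    where
    square-double : ∀ h → + 4 ℤ.* (h ℤ.* h) ≡ (+ 2 ℤ.* h) ℤ.* (+ 2 ℤ.* h)
    square-double = solve-∀
    swap-factors : ∀ R → + 2 ℤ.* (+ 4 ℤ.* R) ≡ + 4 ℤ.* (+ 2 ℤ.* R)
    swap-factors = solve-∀
  g = proj₁ (even-square⇒even h R h²≡2R)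
  h≡2g = proj₂ (even-square⇒even h R h²≡2R)
  regroup : ∀ k₁ k₂ k₃ g →
    + 2 ℤ.* (+ 2 ℤ.* g) ℤ.+ (+ 2 ℤ.* (+ 1 ℤ.+ + 2 ℤ.* k₁) ℤ.+ + 2 ℤ.* (+ 1 ℤ.+ + 2 ℤ.* k₂) ℤ.+ + 2 ℤ.* (+ 1 ℤ.+ + 2 ℤ.* k₃))
    ≡ + 2 ℤ.* (+ 1 ℤ.+ + 2 ℤ.* (+ 1 ℤ.+ k₁ ℤ.+ k₂ ℤ.+ k₃ ℤ.+ g))
  regroup = solve-∀

fromℤ-sum₃ : ∀ a b c → fromℤ (a ℤ.+ b ℤ.+ c) ≡ fromℤ a + fromℤ b + fromℤ c
fromℤ-sum₃ a b c = trans (fromℤ-+ (a ℤ.+ b) c) (cong (_+ fromℤ c) (fromℤ-+ a b))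

-- For s = p₁ + p₂ + p₃ one has (X − s)² = E(p, s) − E(p, X), E the diagonal expansion.
quadratic-root-integral : ∀ p₁ p₂ p₃ f X → let s = p₁ ℤ.+ p₂ ℤ.+ p₃ in
  expansion (fromℤ p₁) (fromℤ p₂) (fromℤ p₃) X (fromℤ p₁) (fromℤ p₂) (fromℤ p₃) X ≡ fromℤ f →
  ∃ λ m → X ≡ fromℤ (m ℤ.+ s) × m ℤ.* m ≡ expansionℤ p₁ p₂ p₃ s p₁ p₂ p₃ s ℤ.- f
quadratic-root-integral p₁ p₂ p₃ f X E≡f = m , X≡m+s , fromℤ-injective (begin
    fromℤ (m ℤ.* m)            ≡⟨ fromℤ-* m m ⟩
    fromℤ m * fromℤ m          ≡⟨ sym (cong₂ _*_ X-S≡m X-S≡m) ⟩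
    (X - S) * (X - S)          ≡⟨ square-integral ⟩
    fromℤ (Eₛ ℤ.- f)           ∎)
  where
  open ≡-Reasoning
  s = p₁ ℤ.+ p₂ ℤ.+ p₃
  S = fromℤ p₁ + fromℤ p₂ + fromℤ p₃
  Eₛ = expansionℤ p₁ p₂ p₃ s p₁ p₂ p₃ s
  completing-square : ∀ p₁ p₂ p₃ x → let S = p₁ + p₂ + p₃ in
    (x - S) * (x - S) ≡ expansion p₁ p₂ p₃ S p₁ p₂ p₃ S + - expansion p₁ p₂ p₃ x p₁ p₂ p₃ x
  completing-square = solve 4 (λ p₁ p₂ p₃ x → let S = p₁ :+ p₂ :+ p₃ in
    (x :- S) :* (x :- S) := P.expansion p₁ p₂ p₃ S p₁ p₂ p₃ S :+ :- P.expansion p₁ p₂ p₃ x p₁ p₂ p₃ x) refl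
    where
    open ℚ-Solver
    module P = Polynomials (ℚ-syntax 4)
  square-integral : (X - S) * (X - S) ≡ fromℤ (Eₛ ℤ.- f)
  square-integral = begin
    (X - S) * (X - S)
      ≡⟨ completing-square (fromℤ p₁) (fromℤ p₂) (fromℤ p₃) X ⟩
    expansion (fromℤ p₁) (fromℤ p₂) (fromℤ p₃) S (fromℤ p₁) (fromℤ p₂) (fromℤ p₃) S
      + - expansion (fromℤ p₁) (fromℤ p₂) (fromℤ p₃) X (fromℤ p₁) (fromℤ p₂) (fromℤ p₃) X
      ≡⟨ cong₂ (λ a b → a + - b)
           (trans (cong (λ t → expansion (fromℤ p₁) (fromℤ p₂) (fromℤ p₃) t (fromℤ p₁) (fromℤ p₂) (fromℤ p₃) t)
                        (sym (fromℤ-sum₃ p₁ p₂ p₃)))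
                  (sym (fromℤ-expansion p₁ p₂ p₃ s p₁ p₂ p₃ s)))
           E≡f ⟩
    fromℤ Eₛ + - fromℤ f
      ≡⟨ sym (trans (fromℤ-+ Eₛ (ℤ.- f)) (cong (_+_ (fromℤ Eₛ)) (fromℤ-neg f))) ⟩
    fromℤ (Eₛ ℤ.- f) ∎
  m = proj₁ (square-integral⇒integral (X - S) (Eₛ ℤ.- f) square-integral)
  X-S≡m = proj₂ (square-integral⇒integral (X - S) (Eₛ ℤ.- f) square-integral)
  X≡m+s : X ≡ fromℤ (m ℤ.+ s)
  X≡m+s = begin
    X                  ≡⟨ add-back X S ⟩
    (X - S) + S        ≡⟨ cong₂ _+_ X-S≡m (sym (fromℤ-sum₃ p₁ p₂ p₃)) ⟩
    fromℤ m + fromℤ s  ≡⟨ sym (fromℤ-+ m s) ⟩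
    fromℤ (m ℤ.+ s)    ∎
    where
    add-back : ∀ a b → a ≡ (a - b) + b
    add-back = solve 2 (λ a b → a := (a :- b) :+ b) refl
      where open ℚ-Solver

TwiceOdd-sym : ∀ u v → TwiceOdd (form2 u v) → TwiceOdd (form2 v u)
TwiceOdd-sym u v (k , e) = k , trans (form2-sym v u) e

-- The Gram expansion at (v, v) is a quadratic equation for form2 v w.
twiceOdd-step : ∀ {x y z w} → DescartesQuadruple x y z w → ∀ v → IsCircle v →
  TwiceOdd (form2 v x) → TwiceOdd (form2 v y) → TwiceOdd (form2 v z) → TwiceOdd (form2 v w)
twiceOdd-step {x} {y} {z} {w} Q v v-circle (k₁ , h₁) (k₂ , h₂) (k₃ , h₃) =
  let (m , X≡m+s , m²≡) = quadratic-root-integral p₁ p₂ p₃ (+ 8 ℤ.* -[1+ 1 ]) (form2 v w) gram-at-v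
      (k , m+s≡2odd) = twiceOdd-square-root k₁ k₂ k₃ m m²≡
  in k , trans X≡m+s (cong fromℤ m+s≡2odd)
  where
  open ≡-Reasoning
  p₁ = twiceOdd k₁
  p₂ = twiceOdd k₂
  p₃ = twiceOdd k₃
  gram-at-v : expansion (fromℤ p₁) (fromℤ p₂) (fromℤ p₃) (form2 v w) (fromℤ p₁) (fromℤ p₂) (fromℤ p₃) (form2 v w)
              ≡ fromℤ (+ 8 ℤ.* -[1+ 1 ])
  gram-at-v = begin
    expansion (fromℤ p₁) (fromℤ p₂) (fromℤ p₃) (form2 v w) (fromℤ p₁) (fromℤ p₂) (fromℤ p₃) (form2 v w)
      ≡⟨ sym (expansion-cong h₁ h₂ h₃ refl (trans (form2-sym x v) h₁) (trans (form2-sym y v) h₂)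
                                           (trans (form2-sym z v) h₃) (form2-sym w v)) ⟩
    expansion (form2 v x) (form2 v y) (form2 v z) (form2 v w) (form2 x v) (form2 y v) (form2 z v) (form2 w v)
      ≡⟨ sym (gram-expansion Q v v) ⟩
    eight * form2 v v              ≡⟨ cong₂ _*_ (sym fromℤ-8) (trans v-circle (sym fromℤ-[-2])) ⟩
    fromℤ (+ 8) * fromℤ -[1+ 1 ]   ≡⟨ sym (fromℤ-* (+ 8) -[1+ 1 ]) ⟩
    fromℤ (+ 8 ℤ.* -[1+ 1 ])       ∎

odd-square⇒odd : ∀ m W → m ℤ.* m ≡ + 1 ℤ.+ + 2 ℤ.* W → ∃ λ d → m ≡ + 1 ℤ.+ + 2 ℤ.* d
odd-square⇒odd m W e with parity m
... | d , inj₂ m≡1+2d = d , m≡1+2d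
... | h , inj₁ m≡2h = ⊥-elim (odd≢even W (h ℤ.* (+ 2 ℤ.* h)) (trans (sym e) (trans (cong (λ z → z ℤ.* z) m≡2h) (square h))))
  where
  square : ∀ h → (+ 2 ℤ.* h) ℤ.* (+ 2 ℤ.* h) ≡ + 2 ℤ.* (h ℤ.* (+ 2 ℤ.* h))
  square = solve-∀

-- With cᵢ = 2 + 4kᵢ and K = Σ kᵢ the hypothesis reads (2 + K)² = 1 + 2 (K + Σ kᵢ²).
twiceOdd-sum : ∀ k₁ k₂ k₃ k₄ → let c₁ = twiceOdd k₁ ; c₂ = twiceOdd k₂ ; c₃ = twiceOdd k₃ ; c₄ = twiceOdd k₄ in
  + 8 ℤ.* -[1+ 1 ] ≡ expansionℤ c₁ c₂ c₃ c₄ c₁ c₂ c₃ c₄ →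
  ∃ λ d → + 2 ℤ.+ (k₁ ℤ.+ k₂ ℤ.+ k₃ ℤ.+ k₄) ≡ + 1 ℤ.+ + 2 ℤ.* d
twiceOdd-sum k₁ k₂ k₃ k₄ self-value = odd-square⇒odd (+ 2 ℤ.+ K) W (ℤ.i-j≡0⇒i≡j _ _
  ([ (λ ()) , (λ e → e) ]′ (ℤ.i*j≡0⇒i≡0∨j≡0 (+ 16)
    (trans (sym sixteen-fold) (trans (cong (ℤ._- + 8 ℤ.* -[1+ 1 ]) (sym self-value)) (ℤ.+-inverseʳ (+ 8 ℤ.* -[1+ 1 ])))))))
  where
  K = k₁ ℤ.+ k₂ ℤ.+ k₃ ℤ.+ k₄
  W = K ℤ.+ (k₁ ℤ.* k₁ ℤ.+ k₂ ℤ.* k₂ ℤ.+ k₃ ℤ.* k₃ ℤ.+ k₄ ℤ.* k₄)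
  sixteen-fold : expansionℤ (twiceOdd k₁) (twiceOdd k₂) (twiceOdd k₃) (twiceOdd k₄)
                            (twiceOdd k₁) (twiceOdd k₂) (twiceOdd k₃) (twiceOdd k₄) ℤ.- + 8 ℤ.* -[1+ 1 ] ≡
    + 16 ℤ.* ((+ 2 ℤ.+ K) ℤ.* (+ 2 ℤ.+ K) ℤ.- (+ 1 ℤ.+ + 2 ℤ.* W))
  sixteen-fold = solve 4 (λ k₁ k₂ k₃ k₄ →
      let C₁ = T k₁ ; C₂ = T k₂ ; C₃ = T k₃ ; C₄ = T k₄ ; K = k₁ :+ k₂ :+ k₃ :+ k₄ in
      P.expansion C₁ C₂ C₃ C₄ C₁ C₂ C₃ C₄ :- con (+ 8) :* con -[1+ 1 ]
      := con (+ 16) :* ((con (+ 2) :+ K) :* (con (+ 2) :+ K)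
                        :- (con (+ 1) :+ con (+ 2) :* (K :+ (k₁ :* k₁ :+ k₂ :* k₂ :+ k₃ :* k₃ :+ k₄ :* k₄))))) refl
    k₁ k₂ k₃ k₄
    where
    open ℤ-Solver
    module P = Polynomials (ℤ-syntax 4)
    T : Polynomial 4 → Polynomial 4
    T k = con (+ 2) :* (con (+ 1) :+ con (+ 2) :* k)

-- With cᵢ = 2 + 4kᵢ and 2 + Σ kᵢ = 1 + 2d, the expansion is 8 Σ (d − kᵢ) bᵢ.
curvature-coefficients : ∀ k₁ k₂ k₃ k₄ b₁ b₂ b₃ b₄ C d → + 2 ℤ.+ (k₁ ℤ.+ k₂ ℤ.+ k₃ ℤ.+ k₄) ≡ + 1 ℤ.+ + 2 ℤ.* d →
  + 8 ℤ.* C ≡ expansionℤ (twiceOdd k₁) (twiceOdd k₂) (twiceOdd k₃) (twiceOdd k₄) b₁ b₂ b₃ b₄ →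
  C ≡ combinationℤ (d ℤ.- k₁) (d ℤ.- k₂) (d ℤ.- k₃) (d ℤ.- k₄) b₁ b₂ b₃ b₄
curvature-coefficients k₁ k₂ k₃ k₄ b₁ b₂ b₃ b₄ C d 2+K≡1+2d curvature-value = ℤ.*-cancelˡ-≡ (+ 8) C S (begin
    + 8 ℤ.* C              ≡⟨ curvature-value ⟩
    expansionℤ (twiceOdd k₁) (twiceOdd k₂) (twiceOdd k₃) (twiceOdd k₄) b₁ b₂ b₃ b₄
                           ≡⟨ by-parity ⟩
    + 8 ℤ.* S ℤ.+ + 4 ℤ.* (+ 2 ℤ.+ K ℤ.- (+ 1 ℤ.+ + 2 ℤ.* d)) ℤ.* Σb
                           ≡⟨ cong (λ z → + 8 ℤ.* S ℤ.+ + 4 ℤ.* (z ℤ.- (+ 1 ℤ.+ + 2 ℤ.* d)) ℤ.* Σb) 2+K≡1+2d ⟩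
    + 8 ℤ.* S ℤ.+ + 4 ℤ.* (+ 1 ℤ.+ + 2 ℤ.* d ℤ.- (+ 1 ℤ.+ + 2 ℤ.* d)) ℤ.* Σb
                           ≡⟨ cong (λ z → + 8 ℤ.* S ℤ.+ + 4 ℤ.* z ℤ.* Σb) (ℤ.+-inverseʳ (+ 1 ℤ.+ + 2 ℤ.* d)) ⟩
    + 8 ℤ.* S ℤ.+ + 0      ≡⟨ ℤ.+-identityʳ (+ 8 ℤ.* S) ⟩
    + 8 ℤ.* S              ∎)
  where
  open ≡-Reasoning
  K = k₁ ℤ.+ k₂ ℤ.+ k₃ ℤ.+ k₄
  Σb = b₁ ℤ.+ b₂ ℤ.+ b₃ ℤ.+ b₄
  S = combinationℤ (d ℤ.- k₁) (d ℤ.- k₂) (d ℤ.- k₃) (d ℤ.- k₄) b₁ b₂ b₃ b₄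
  by-parity : expansionℤ (twiceOdd k₁) (twiceOdd k₂) (twiceOdd k₃) (twiceOdd k₄) b₁ b₂ b₃ b₄ ≡
    + 8 ℤ.* S ℤ.+ + 4 ℤ.* (+ 2 ℤ.+ K ℤ.- (+ 1 ℤ.+ + 2 ℤ.* d)) ℤ.* Σb
  by-parity = solve 9 (λ k₁ k₂ k₃ k₄ b₁ b₂ b₃ b₄ d →
      P.expansion (T k₁) (T k₂) (T k₃) (T k₄) b₁ b₂ b₃ b₄
      := con (+ 8) :* P.combination (d :- k₁) (d :- k₂) (d :- k₃) (d :- k₄) b₁ b₂ b₃ b₄
         :+ con (+ 4) :* (con (+ 2) :+ (k₁ :+ k₂ :+ k₃ :+ k₄) :- (con (+ 1) :+ con (+ 2) :* d)) :* (b₁ :+ b₂ :+ b₃ :+ b₄)) refl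
    k₁ k₂ k₃ k₄ b₁ b₂ b₃ b₄ d
    where
    open ℤ-Solver
    module P = Polynomials (ℤ-syntax 9)
    T : Polynomial 9 → Polynomial 9
    T k = con (+ 2) :* (con (+ 1) :+ con (+ 2) :* k)

∣⇒∣ℚ : ∀ {d z} → + d ℤ.∣ z → d ∣ℚ fromℤ z
∣⇒∣ℚ {d} {z} (divides k z≡kd) = k , trans (cong fromℤ (trans z≡kd (ℤ.*-comm k (+ d)))) (fromℤ≡/1 (+ d ℤ.* k))

∣ℚ⇒∣ : ∀ {d z} → d ∣ℚ fromℤ z → + d ℤ.∣ z
∣ℚ⇒∣ {d} {z} (k , e) = divides k (trans (fromℤ-injective (trans e (sym (fromℤ≡/1 (+ d ℤ.* k))))) (ℤ.*-comm (+ d) k))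

∣-combination : ∀ {d} a₁ a₂ a₃ a₄ {b₁ b₂ b₃ b₄} → d ℤ.∣ b₁ → d ℤ.∣ b₂ → d ℤ.∣ b₃ → d ℤ.∣ b₄ →
  d ℤ.∣ combinationℤ a₁ a₂ a₃ a₄ b₁ b₂ b₃ b₄
∣-combination a₁ a₂ a₃ a₄ d₁ d₂ d₃ d₄ =
  ℤ.∣m∣n⇒∣m+n (ℤ.∣m∣n⇒∣m+n (ℤ.∣m∣n⇒∣m+n (ℤ.∣n⇒∣m*n a₁ d₁) (ℤ.∣n⇒∣m*n a₂ d₂)) (ℤ.∣n⇒∣m*n a₃ d₃)) (ℤ.∣n⇒∣m*n a₄ d₄)

∣+0 : ∀ {n} → + n ℤ.∣ + 0
∣+0 = divides (+ 0) refl

prime-divisor : ∀ d → 2 ≤ d → ∃ λ p → Prime p × p ℕ.∣ d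
prime-divisor 1 (s≤s ())
prime-divisor d@(suc (suc _)) _ with factorise d
... | record { factors = List.[] ; isFactorisation = () }
... | record { factors = p List.∷ ps ; isFactorisation = e ; factorsPrime = p-prime All.∷ _ } =
  p , p-prime , subst (p ℕ.∣_) (sym e) (ℕ.m∣m*n (product ps))

no-common-prime⇒coprime : ∀ {A Z} → A ≢ + 0 → (∀ p → Prime p → + p ℤ.∣ A → + p ℤ.∣ Z → ⊥) →
  ∀ d → + d ℤ.∣ A → + d ℤ.∣ Z → d ≡ 1
no-common-prime⇒coprime A≢0 _ zero (divides q A≡q*0) _ = ⊥-elim (A≢0 (trans A≡q*0 (ℤ.*-zeroʳ q)))
no-common-prime⇒coprime _ _ 1 _ _ = refl
no-common-prime⇒coprime _ no-common d@(suc (suc _)) d∣A d∣Z =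
  let (p , p-prime , p∣d) = prime-divisor d (s≤s (s≤s z≤n))
  in ⊥-elim (no-common p p-prime (ℤ.∣-trans (ℤ.∣ᵤ⇒∣ p∣d) d∣A) (ℤ.∣-trans (ℤ.∣ᵤ⇒∣ p∣d) d∣Z))

-- m′ is the product of the prime factors of m (with multiplicity) not dividing c.
coprime-part : ∀ m c .{{_ : ℕ.NonZero m}} → ∃ λ m′ → Coprime m′ c × (∀ {p} → Prime p → p ℕ.∣ m → ¬ p ℕ.∣ c → p ℕ.∣ m′)
coprime-part m c = product kept , coprime , divides-kept
  where
  open PrimeFactorisation (factorise m)
  keep? = λ q → ¬? (q ∣? c)
  kept = filter keep? factors
  kept-prime = filter⁺ keep? factorsPrime
  divides-kept : ∀ {p} → Prime p → p ℕ.∣ m → ¬ p ℕ.∣ c → p ℕ.∣ product kept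
  divides-kept p-prime p∣m p∤c = ∈⇒∣product (∈-filter⁺ keep?
    (factorisationHasAllPrimeFactors p-prime (subst (_ ℕ.∣_) isFactorisation p∣m) factorsPrime) p∤c)
  coprime : Coprime (product kept) c
  coprime {zero} (0∣m′ , _) = ⊥-elim (ℕ.≢-nonZero⁻¹ (product kept) {{productOfPrimes≢0 kept-prime}} (ℕ.0∣⇒≡0 0∣m′))
  coprime {1} _ = refl
  coprime {d@(suc (suc _))} (d∣m′ , d∣c) =
    let (q , q-prime , q∣d) = prime-divisor d (s≤s (s≤s z≤n))
    in ⊥-elim (proj₂ (∈-filter⁻ keep? {xs = factors}
         (factorisationHasAllPrimeFactors q-prime (ℕ.∣-trans q∣d d∣m′) kept-prime)) (ℕ.∣-trans q∣d d∣c))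

±1⇒square≡1 : ∀ {k v} → k ℤ.∣ v ℤ.- + 1 ⊎ k ℤ.∣ v ℤ.+ + 1 → k ℤ.∣ v ℤ.* v ℤ.- + 1
±1⇒square≡1 {k} {v} k∣v∓1 = subst (k ℤ.∣_) (sym (factor v))
  ([ ℤ.∣m⇒∣m*n (v ℤ.+ + 1) , ℤ.∣n⇒∣m*n (v ℤ.- + 1) ]′ k∣v∓1)
  where
  factor : ∀ v → v ℤ.* v ℤ.- + 1 ≡ (v ℤ.- + 1) ℤ.* (v ℤ.+ + 1)
  factor = solve-∀

-- Bézout gives v ∈ m′ℕ with v ≡ ±1 (mod c).
square≡1-mod : ∀ {m′ c} → Coprime m′ c → ∃ λ v → m′ ℕ.∣ v × + c ℤ.∣ + v ℤ.* + v ℤ.- + 1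
square≡1-mod {m′} {c} coprime with coprime-Bézout coprime
... | Bézout.+- x y 1+yc≡xm′ = x ℕ.* m′ , ℕ.n∣m*n x , ±1⇒square≡1 {v = + (x ℕ.* m′)} (inj₁ (divides (+ y) (begin
    + (x ℕ.* m′) ℤ.- + 1         ≡⟨ cong (λ n → + n ℤ.- + 1) (sym 1+yc≡xm′) ⟩
    + 1 ℤ.+ + (y ℕ.* c) ℤ.- + 1  ≡⟨ cancel (+ (y ℕ.* c)) ⟩
    + (y ℕ.* c)                  ≡⟨ ℤ.pos-* y c ⟩
    + y ℤ.* + c                  ∎)))
  where
  open ≡-Reasoning
  cancel : ∀ a → + 1 ℤ.+ a ℤ.- + 1 ≡ a
  cancel = solve-∀
... | Bézout.-+ x y 1+xm′≡yc = x ℕ.* m′ , ℕ.n∣m*n x , ±1⇒square≡1 {v = + (x ℕ.* m′)} (inj₂ (divides (+ y) (begin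
    + (x ℕ.* m′) ℤ.+ + 1         ≡⟨ cong +_ (ℕ.+-comm (x ℕ.* m′) 1) ⟩
    + (1 ℕ.+ x ℕ.* m′)           ≡⟨ cong +_ 1+xm′≡yc ⟩
    + (y ℕ.* c)                  ≡⟨ ℤ.pos-* y c ⟩
    + y ℤ.* + c                  ∎)))
  where open ≡-Reasoning

necklaceCurvature : (A B C₀ C₁ x : ℤ) → ℤ
necklaceCurvature = Polynomials.necklace ℤ.+-*-rawRing

module _ (A B C₀ C₁ : ℤ) where
  open ℤ-Solver
  private module E = Polynomials (ℤ-syntax 5)

  necklaceCurvature-0 : necklaceCurvature A B C₀ C₁ (+ 0) ≡ C₀
  necklaceCurvature-0 = trans (ℤ.+-identityʳ _) (ℤ.+-identityʳ C₀)

  necklaceCurvature-1 : necklaceCurvature A B C₀ C₁ (+ 1) ≡ C₁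
  necklaceCurvature-1 = solve 4 (λ A B C₀ C₁ → F.necklace A B C₀ C₁ (con (+ 1)) := C₁) refl A B C₀ C₁
    where module F = Polynomials (ℤ-syntax 4)

  necklaceCurvature-step : ∀ x → necklaceCurvature A B C₀ C₁ (+ 1 ℤ.+ (+ 1 ℤ.+ x)) ≡
    + 2 ℤ.* (A ℤ.+ B ℤ.+ necklaceCurvature A B C₀ C₁ (+ 1 ℤ.+ x)) ℤ.- necklaceCurvature A B C₀ C₁ x
  necklaceCurvature-step = solve 5 (λ A B C₀ C₁ x →
    E.necklace A B C₀ C₁ (con (+ 1) :+ (con (+ 1) :+ x))
    := con (+ 2) :* (A :+ B :+ E.necklace A B C₀ C₁ (con (+ 1) :+ x)) :- E.necklace A B C₀ C₁ x) refl A B C₀ C₁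

  ∣necklace⇒∣C₀ : ∀ {k} x → k ℤ.∣ x → k ℤ.∣ necklaceCurvature A B C₀ C₁ x → k ℤ.∣ C₀
  ∣necklace⇒∣C₀ {k} x k∣x k∣N = ℤ.∣m+n∣n⇒∣m (subst (k ℤ.∣_) (expand x) k∣N) (ℤ.∣m⇒∣m*n _ k∣x)
    where
    expand : ∀ x → necklaceCurvature A B C₀ C₁ x ≡ C₀ ℤ.+ x ℤ.* (C₁ ℤ.- C₀ ℤ.+ (x ℤ.- + 1) ℤ.* (A ℤ.+ B))
    expand = solve 5 (λ A B C₀ C₁ x → E.necklace A B C₀ C₁ x
      := C₀ :+ x :* (C₁ :- C₀ :+ (x :- con (+ 1)) :* (A :+ B))) refl A B C₀ C₁

  ∣necklace⇒∣C₁ : ∀ {k} x → k ℤ.∣ x ℤ.- + 1 → k ℤ.∣ necklaceCurvature A B C₀ C₁ x → k ℤ.∣ C₁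
  ∣necklace⇒∣C₁ {k} x k∣x-1 k∣N = ℤ.∣m+n∣n⇒∣m (subst (k ℤ.∣_) (expand x) k∣N) (ℤ.∣m⇒∣m*n _ k∣x-1)
    where
    expand : ∀ x → necklaceCurvature A B C₀ C₁ x ≡ C₁ ℤ.+ (x ℤ.- + 1) ℤ.* (C₁ ℤ.- C₀ ℤ.+ x ℤ.* (A ℤ.+ B))
    expand = solve 5 (λ A B C₀ C₁ x → E.necklace A B C₀ C₁ x
      := C₁ :+ (x :- con (+ 1)) :* (C₁ :- C₀ :+ x :* (A :+ B))) refl A B C₀ C₁

-- n ≡ 1 modulo the primes of m dividing C₀ and n ≡ 0 modulo the others, so that
-- modulo each prime of m the necklace curvature at n is C₁, resp. C₀.
coprime-necklace-index : ∀ m A B C₀ C₁ .{{_ : ℕ.NonZero m}} →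
  (∀ p → Prime p → p ℕ.∣ m → + p ℤ.∣ C₀ → + p ℤ.∣ C₁ → ⊥) →
  ∃ λ n → ∀ p → Prime p → p ℕ.∣ m → + p ℤ.∣ necklaceCurvature A B C₀ C₁ (+ n) → ⊥
coprime-necklace-index m A B C₀ C₁ no-common with coprime-part m ℤ.∣ C₀ ∣
... | m′ , m′⊥c , primes-of-m′ with square≡1-mod m′⊥c
... | v , m′∣v , c∣v²-1 = n , avoids
  where
  n = v ℕ.* v
  c∣n-1 : + ℤ.∣ C₀ ∣ ℤ.∣ + n ℤ.- + 1
  c∣n-1 = subst (λ z → + ℤ.∣ C₀ ∣ ℤ.∣ z ℤ.- + 1) (sym (ℤ.pos-* v v)) c∣v²-1
  avoids : ∀ p → Prime p → p ℕ.∣ m → + p ℤ.∣ necklaceCurvature A B C₀ C₁ (+ n) → ⊥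
  avoids p p-prime p∣m p∣N with p ∣? ℤ.∣ C₀ ∣
  ... | yes p∣C₀ = no-common p p-prime p∣m (ℤ.∣ᵤ⇒∣ p∣C₀)
        (∣necklace⇒∣C₁ A B C₀ C₁ (+ n) (ℤ.∣-trans (ℤ.∣ᵤ⇒∣ {+ p} {+ ℤ.∣ C₀ ∣} p∣C₀) c∣n-1) p∣N)
  ... | no p∤C₀ = p∤C₀ (ℤ.∣⇒∣ᵤ (∣necklace⇒∣C₀ A B C₀ C₁ (+ n)
        (ℤ.∣ᵤ⇒∣ {+ p} {+ n} (ℕ.∣m⇒∣m*n v (ℕ.∣-trans (primes-of-m′ p-prime p∣m p∤C₀) m′∣v))) p∣N))

-- The second circle tangent to a, b and y besides x.
reflect : Circle → Circle → Circle → Circle → Circle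
reflect a b y x = circle (two * (bbar a + bbar b + bbar y) - bbar x) (two * (curv a + curv b + curv y) - curv x)
                         (two * (bx a + bx b + bx y) - bx x) (two * (by a + by b + by y) - by x)

form2-reflect : ∀ a b y x z → form2 (reflect a b y x) z ≡ two * (form2 a z + form2 b z + form2 y z) - form2 x z
form2-reflect a b y x z = solve 21 (λ t a₁ a₂ a₃ a₄ b₁ b₂ b₃ b₄ y₁ y₂ y₃ y₄ x₁ x₂ x₃ x₄ z₁ z₂ z₃ z₄ →
    let R : Polynomial 21 → Polynomial 21 → Polynomial 21 → Polynomial 21 → Polynomial 21
        R a b y x = t :* (a :+ b :+ y) :- x
    in S.pairing t (R a₁ b₁ y₁ x₁) (R a₂ b₂ y₂ x₂) (R a₃ b₃ y₃ x₃) (R a₄ b₄ y₄ x₄) z₁ z₂ z₃ z₄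
       := t :* (S.pairing t a₁ a₂ a₃ a₄ z₁ z₂ z₃ z₄ :+ S.pairing t b₁ b₂ b₃ b₄ z₁ z₂ z₃ z₄ :+ S.pairing t y₁ y₂ y₃ y₄ z₁ z₂ z₃ z₄)
          :- S.pairing t x₁ x₂ x₃ x₄ z₁ z₂ z₃ z₄) refl
  two (bbar a) (curv a) (bx a) (by a) (bbar b) (curv b) (bx b) (by b) (bbar y) (curv y) (bx y) (by y)
  (bbar x) (curv x) (bx x) (by x) (bbar z) (curv z) (bx z) (by z)
  where
  open ℚ-Solver
  module S = Polynomials (ℚ-syntax 21)

reflect-quadruple : ∀ {a b x y} → DescartesQuadruple a b x y → DescartesQuadruple a b y (reflect a b y x)
reflect-quadruple {a} {b} {x} {y} Q = record
  { isCircle₁ = isCircle₁ ; isCircle₂ = isCircle₂ ; isCircle₃ = isCircle₄ ; isCircle₄ = r-circle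
  ; tangent₁₂ = tangent₁₂ ; tangent₁₃ = tangent₁₄ ; tangent₁₄ = Tangent-sym r a r-a
  ; tangent₂₃ = tangent₂₄ ; tangent₂₄ = Tangent-sym r b r-b ; tangent₃₄ = Tangent-sym r y r-y }
  where
  open DescartesQuadruple Q
  r = reflect a b y x
  value : ∀ z {p q s u} → form2 a z ≡ p → form2 b z ≡ q → form2 y z ≡ s → form2 x z ≡ u →
    form2 r z ≡ two * (p + q + s) - u
  value z refl refl refl refl = form2-reflect a b y x z
  r-a : Tangent r a
  r-a = value a isCircle₁ tangent₂₁ tangent₄₁ tangent₃₁
  r-b : Tangent r b
  r-b = value b tangent₁₂ isCircle₂ tangent₄₂ tangent₃₂
  r-y : Tangent r y
  r-y = value y tangent₁₄ tangent₂₄ isCircle₄ tangent₃₄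
  r-circle : IsCircle r
  r-circle = value r (trans (form2-sym a r) r-a) (trans (form2-sym b r) r-b) (trans (form2-sym y r) r-y)
    (trans (form2-sym x r) (value x tangent₁₃ tangent₂₃ tangent₄₃ isCircle₃))

fromℤ-reflect : ∀ A B Y X → fromℤ (+ 2 ℤ.* (A ℤ.+ B ℤ.+ Y) ℤ.- X) ≡ two * (fromℤ A + fromℤ B + fromℤ Y) - fromℤ X
fromℤ-reflect A B Y X = begin
  fromℤ (+ 2 ℤ.* (A ℤ.+ B ℤ.+ Y) ℤ.- X)             ≡⟨ fromℤ-+ (+ 2 ℤ.* (A ℤ.+ B ℤ.+ Y)) (ℤ.- X) ⟩
  fromℤ (+ 2 ℤ.* (A ℤ.+ B ℤ.+ Y)) + fromℤ (ℤ.- X)   ≡⟨ cong₂ _+_ (fromℤ-* (+ 2) (A ℤ.+ B ℤ.+ Y)) (fromℤ-neg X) ⟩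
  fromℤ (+ 2) * fromℤ (A ℤ.+ B ℤ.+ Y) - fromℤ X     ≡⟨ cong₂ (λ s t → s * t - fromℤ X) fromℤ-2 (fromℤ-sum₃ A B Y) ⟩
  two * (fromℤ A + fromℤ B + fromℤ Y) - fromℤ X     ∎
  where open ≡-Reasoning

-- The circles tangent to both a and b, in the order in which they touch.
module Necklace {a b c d} (Q : DescartesQuadruple a b c d) where

  bead : ℕ → Circle
  bead 0 = c
  bead 1 = d
  bead (suc (suc n)) = reflect a b (bead (suc n)) (bead n)

  bead-quadruple : ∀ n → DescartesQuadruple a b (bead n) (bead (suc n))
  bead-quadruple zero = Q
  bead-quadruple (suc n) = reflect-quadruple (bead-quadruple n)

  bead-curvature : ∀ {A B C₀ C₁} → curv a ≡ fromℤ A → curv b ≡ fromℤ B → curv c ≡ fromℤ C₀ → curv d ≡ fromℤ C₁ →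
    ∀ n → curv (bead n) ≡ fromℤ (necklaceCurvature A B C₀ C₁ (+ n))
  bead-curvature {A} {B} {C₀} {C₁} hA hB hC₀ hC₁ = go
    where
    go : ∀ n → curv (bead n) ≡ fromℤ (necklaceCurvature A B C₀ C₁ (+ n))
    go zero = trans hC₀ (cong fromℤ (sym (necklaceCurvature-0 A B C₀ C₁)))
    go 1 = trans hC₁ (cong fromℤ (sym (necklaceCurvature-1 A B C₀ C₁)))
    go (suc (suc n)) = begin
      two * (curv a + curv b + curv (bead (suc n))) - curv (bead n)
        ≡⟨ cong₂ (λ s t → two * s - t) (cong₂ _+_ (cong₂ _+_ hA hB) (go (suc n))) (go n) ⟩
      two * (fromℤ A + fromℤ B + fromℤ (necklaceCurvature A B C₀ C₁ (+ suc n))) - fromℤ (necklaceCurvature A B C₀ C₁ (+ n))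
        ≡⟨ sym (fromℤ-reflect A B _ _) ⟩
      fromℤ (+ 2 ℤ.* (A ℤ.+ B ℤ.+ necklaceCurvature A B C₀ C₁ (+ suc n)) ℤ.- necklaceCurvature A B C₀ C₁ (+ n))
        ≡⟨ cong fromℤ (sym (necklaceCurvature-step A B C₀ C₁ (+ n))) ⟩
      fromℤ (necklaceCurvature A B C₀ C₁ (+ suc (suc n))) ∎
      where open ≡-Reasoning

-- z w = x² + y² − 2 x y; if z ≤ w, then using x, y ≤ z this would force x y ≤ 0.
descent-step : ∀ {x y z w} → 1 ≤ x → 1 ≤ y → x ≤ z → y ≤ z → z ℕ.* w ℕ.+ 2 ℕ.* (x ℕ.* y) ≡ x ℕ.* x ℕ.+ y ℕ.* y → w < z
descent-step {x} {y} {z} {w} 1≤x 1≤y x≤z y≤z e = ℕ.≰⇒> λ z≤w → ℕ.<⇒≱ xy<2xy (ℕ.+-cancelˡ-≤ (z ℕ.* w) _ _ (begin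
    z ℕ.* w ℕ.+ 2 ℕ.* (x ℕ.* y)  ≡⟨ e ⟩
    x ℕ.* x ℕ.+ y ℕ.* y          ≤⟨ squares≤ ⟩
    x ℕ.* y ℕ.+ z ℕ.* z          ≤⟨ ℕ.+-monoʳ-≤ (x ℕ.* y) (ℕ.*-monoʳ-≤ z z≤w) ⟩
    x ℕ.* y ℕ.+ z ℕ.* w          ≡⟨ ℕ.+-comm (x ℕ.* y) (z ℕ.* w) ⟩
    z ℕ.* w ℕ.+ x ℕ.* y          ∎))
  where
  open ℕ.≤-Reasoning
  xy<2xy : x ℕ.* y < 2 ℕ.* (x ℕ.* y)
  xy<2xy = ℕ.m<m+n (x ℕ.* y) (subst (1 ≤_) (sym (ℕ.+-identityʳ (x ℕ.* y))) (ℕ.*-mono-≤ 1≤x 1≤y))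
  squares≤ : x ℕ.* x ℕ.+ y ℕ.* y ≤ x ℕ.* y ℕ.+ z ℕ.* z
  squares≤ with ℕ.≤-total x y
  ... | inj₁ x≤y = ℕ.+-mono-≤ (ℕ.*-monoʳ-≤ x x≤y) (ℕ.*-mono-≤ y≤z y≤z)
  ... | inj₂ y≤x = subst (x ℕ.* x ℕ.+ y ℕ.* y ≤_) (ℕ.+-comm (z ℕ.* z) (x ℕ.* y))
                     (ℕ.+-mono-≤ (ℕ.*-mono-≤ x≤z x≤z) (subst (y ℕ.* y ≤_) (ℕ.*-comm y x) (ℕ.*-monoʳ-≤ y y≤x)))

square≡∣∣² : ∀ i → i ℤ.* i ≡ + (ℤ.∣ i ∣ ℕ.* ℤ.∣ i ∣)
square≡∣∣² (+ n) = sym (ℤ.pos-* n n)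
square≡∣∣² -[1+ n ] = refl

1≤∣∣ : ∀ {X} → X ≢ + 0 → 1 ≤ ℤ.∣ X ∣
1≤∣∣ {+ zero} X≢0 = ⊥-elim (X≢0 refl)
1≤∣∣ {+ suc n} _ = s≤s z≤n
1≤∣∣ { -[1+ n ]} _ = s≤s z≤n

-- With curvatures 0, X, Y, Z in a Descartes quadruple, reflecting the circle of largest
-- curvature |Z| yields the curvature Z′ = 2 (X + Y) − Z with Z Z′ = (X − Y)² and 4 X Y = (Z − X − Y)².
reflection-shrinks : ∀ {X Y Z} → X ≢ + 0 → Y ≢ + 0 → ℤ.∣ X ∣ ≤ ℤ.∣ Z ∣ → ℤ.∣ Y ∣ ≤ ℤ.∣ Z ∣ →
  expansionℤ (+ 0) X Y Z (+ 0) X Y Z ≡ + 0 → ℤ.∣ + 2 ℤ.* (+ 0 ℤ.+ X ℤ.+ Y) ℤ.- Z ∣ < ℤ.∣ Z ∣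
reflection-shrinks {X} {Y} {Z} X≢0 Y≢0 x≤z y≤z descartes =
  descent-step (1≤∣∣ X≢0) (1≤∣∣ Y≢0) x≤z y≤z (ℤ.+-injective (begin
    + (ℤ.∣ Z ∣ ℕ.* ℤ.∣ Z′ ∣ ℕ.+ 2 ℕ.* (ℤ.∣ X ∣ ℕ.* ℤ.∣ Y ∣))
      ≡⟨ cong₂ ℤ._+_ (cong +_ (sym (ℤ.abs-* Z Z′))) (trans (ℤ.pos-* 2 (ℤ.∣ X ∣ ℕ.* ℤ.∣ Y ∣)) (cong (+ 2 ℤ.*_) (cong +_ (sym (ℤ.abs-* X Y))))) ⟩
    + ℤ.∣ Z ℤ.* Z′ ∣ ℤ.+ + 2 ℤ.* + ℤ.∣ X ℤ.* Y ∣
      ≡⟨ cong₂ (λ s t → s ℤ.+ + 2 ℤ.* t) (sym (nonNegative (Z ℤ.* Z′) (trans (identity₃ X Y Z) (vanishing (X ℤ.- Y)))))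
                                          (sym (4*nonNegative (X ℤ.* Y) (trans (identity₂ X Y Z) (vanishing (Z ℤ.- X ℤ.- Y))))) ⟩
    Z ℤ.* Z′ ℤ.+ + 2 ℤ.* (X ℤ.* Y)
      ≡⟨ trans (identity₁ X Y Z) (trans (cong (ℤ._+_ (X ℤ.* X ℤ.+ Y ℤ.* Y)) descartes) (ℤ.+-identityʳ _)) ⟩
    X ℤ.* X ℤ.+ Y ℤ.* Y
      ≡⟨ cong₂ ℤ._+_ (square≡∣∣² X) (square≡∣∣² Y) ⟩
    + (ℤ.∣ X ∣ ℕ.* ℤ.∣ X ∣ ℕ.+ ℤ.∣ Y ∣ ℕ.* ℤ.∣ Y ∣) ∎))
  where
  open ≡-Reasoning
  Z′ = + 2 ℤ.* (+ 0 ℤ.+ X ℤ.+ Y) ℤ.- Z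
  E = expansionℤ (+ 0) X Y Z (+ 0) X Y Z
  vanishing : ∀ s → s ℤ.* s ℤ.+ E ≡ + (ℤ.∣ s ∣ ℕ.* ℤ.∣ s ∣)
  vanishing s = trans (cong (ℤ._+_ (s ℤ.* s)) descartes) (trans (ℤ.+-identityʳ (s ℤ.* s)) (square≡∣∣² s))
  nonNegative : ∀ i {n} → i ≡ + n → i ≡ + ℤ.∣ i ∣
  nonNegative (+ _) _ = refl
  4*nonNegative : ∀ i {n} → + 4 ℤ.* i ≡ + n → i ≡ + ℤ.∣ i ∣
  4*nonNegative (+ _) _ = refl
  module P = Polynomials (ℤ-syntax 3)
  identity₁ : ∀ X Y Z → Z ℤ.* (+ 2 ℤ.* (+ 0 ℤ.+ X ℤ.+ Y) ℤ.- Z) ℤ.+ + 2 ℤ.* (X ℤ.* Y) ≡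
    X ℤ.* X ℤ.+ Y ℤ.* Y ℤ.+ expansionℤ (+ 0) X Y Z (+ 0) X Y Z
  identity₁ = solve 3 (λ X Y Z → Z :* (con (+ 2) :* (con (+ 0) :+ X :+ Y) :- Z) :+ con (+ 2) :* (X :* Y)
    := X :* X :+ Y :* Y :+ P.expansion (con (+ 0)) X Y Z (con (+ 0)) X Y Z) refl
    where open ℤ-Solver
  identity₂ : ∀ X Y Z → + 4 ℤ.* (X ℤ.* Y) ≡ (Z ℤ.- X ℤ.- Y) ℤ.* (Z ℤ.- X ℤ.- Y) ℤ.+ expansionℤ (+ 0) X Y Z (+ 0) X Y Z
  identity₂ = solve 3 (λ X Y Z → con (+ 4) :* (X :* Y)
    := (Z :- X :- Y) :* (Z :- X :- Y) :+ P.expansion (con (+ 0)) X Y Z (con (+ 0)) X Y Z) refl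
    where open ℤ-Solver
  identity₃ : ∀ X Y Z → Z ℤ.* (+ 2 ℤ.* (+ 0 ℤ.+ X ℤ.+ Y) ℤ.- Z) ≡ (X ℤ.- Y) ℤ.* (X ℤ.- Y) ℤ.+ expansionℤ (+ 0) X Y Z (+ 0) X Y Z
  identity₃ = solve 3 (λ X Y Z → Z :* (con (+ 2) :* (con (+ 0) :+ X :+ Y) :- Z)
    := (X :- Y) :* (X :- Y) :+ P.expansion (con (+ 0)) X Y Z (con (+ 0)) X Y Z) refl
    where open ℤ-Solver

largest : ∀ x y z → (x ≤ z × y ≤ z) ⊎ (x ≤ y × z ≤ y) ⊎ (y ≤ x × z ≤ x)
largest x y z with ℕ.≤-total x z | ℕ.≤-total y z | ℕ.≤-total x y
... | inj₁ x≤z | inj₁ y≤z | _       = inj₁ (x≤z , y≤z)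
... | inj₁ x≤z | inj₂ z≤y | _       = inj₂ (inj₁ (ℕ.≤-trans x≤z z≤y , z≤y))
... | inj₂ z≤x | _       | inj₁ x≤y = inj₂ (inj₁ (x≤y , ℕ.≤-trans z≤x x≤y))
... | inj₂ z≤x | _       | inj₂ y≤x = inj₂ (inj₂ (y≤x , z≤x))

+-reorder₁₃₂ : ∀ a b c → a ℕ.+ b ℕ.+ c ≡ a ℕ.+ c ℕ.+ b
+-reorder₁₃₂ = ℕ-Solver.solve-∀

+-reorder₂₃₁ : ∀ a b c → a ℕ.+ b ℕ.+ c ≡ b ℕ.+ c ℕ.+ a
+-reorder₂₃₁ = ℕ-Solver.solve-∀

module Packing (D : Vec Circle 4) (isD : IsDescartes D) where

  P : Circle → Set
  P = InPacking D

  isCircle : ∀ {u} → P u → IsCircle u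
  isCircle (initial i) = proj₁ isD i
  isCircle (add _ _ _ _ _ _ _ _ _ _ w-circle _ _ _) = w-circle

  added-quadruple : ∀ {a b c w} → P a → P b → P c → Tangent a b → Tangent b c → Tangent a c →
    IsCircle w → Tangent w a → Tangent w b → Tangent w c → DescartesQuadruple a b c w
  added-quadruple {a} {b} {c} {w} pa pb pc tab tbc tac w-circle twa twb twc = record
    { isCircle₁ = isCircle pa ; isCircle₂ = isCircle pb ; isCircle₃ = isCircle pc ; isCircle₄ = w-circle
    ; tangent₁₂ = tab ; tangent₁₃ = tac ; tangent₁₄ = Tangent-sym w a twa
    ; tangent₂₃ = tbc ; tangent₂₄ = Tangent-sym w b twb ; tangent₃₄ = Tangent-sym w c twc }

  twiceOdd-root : ∀ i {v} → P v → TwiceOdd (form2 (lookup D i) v)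
  twiceOdd-root i (initial j) with i ≟ j
  ... | yes refl = -[1+ 0 ] , trans (proj₁ isD i) (sym fromℤ-[-2])
  ... | no i≢j   = + 0 , trans (proj₂ isD i j i≢j) (sym fromℤ-2)
  twiceOdd-root i (add a b c w pa pb pc tab tbc tac w-circle twa twb twc) =
    twiceOdd-step (added-quadruple pa pb pc tab tbc tac w-circle twa twb twc) (lookup D i) (proj₁ isD i)
      (twiceOdd-root i pa) (twiceOdd-root i pb) (twiceOdd-root i pc)

  twiceOdd-packing : ∀ {u v} → P u → P v → TwiceOdd (form2 u v)
  twiceOdd-packing (initial i) pv = twiceOdd-root i pv
  twiceOdd-packing {v = v} (add a b c w pa pb pc tab tbc tac w-circle twa twb twc) pv =
    TwiceOdd-sym v w (twiceOdd-step (added-quadruple pa pb pc tab tbc tac w-circle twa twb twc) v (isCircle pv)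
      (TwiceOdd-sym a v (twiceOdd-packing pa pv)) (TwiceOdd-sym b v (twiceOdd-packing pb pv))
      (TwiceOdd-sym c v (twiceOdd-packing pc pv)))

  curvature-combination : ∀ {q₁ q₂ q₃ q₄ u} → DescartesQuadruple q₁ q₂ q₃ q₄ → P q₁ → P q₂ → P q₃ → P q₄ → P u →
    ∀ {b₁ b₂ b₃ b₄ C} → curv q₁ ≡ fromℤ b₁ → curv q₂ ≡ fromℤ b₂ → curv q₃ ≡ fromℤ b₃ → curv q₄ ≡ fromℤ b₄ →
    curv u ≡ fromℤ C → ∃ λ a₁ → ∃ λ a₂ → ∃ λ a₃ → ∃ λ a₄ → C ≡ combinationℤ a₁ a₂ a₃ a₄ b₁ b₂ b₃ b₄
  curvature-combination {q₁} {q₂} {q₃} {q₄} {u} Q p₁ p₂ p₃ p₄ pu {b₁} {b₂} {b₃} {b₄} {C} h₁ h₂ h₃ h₄ hC =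
    combine (twiceOdd-packing pu p₁) (twiceOdd-packing pu p₂) (twiceOdd-packing pu p₃) (twiceOdd-packing pu p₄)
    where
    combine : TwiceOdd (form2 u q₁) → TwiceOdd (form2 u q₂) → TwiceOdd (form2 u q₃) → TwiceOdd (form2 u q₄) →
      ∃ λ a₁ → ∃ λ a₂ → ∃ λ a₃ → ∃ λ a₄ → C ≡ combinationℤ a₁ a₂ a₃ a₄ b₁ b₂ b₃ b₄
    combine (k₁ , f₁) (k₂ , f₂) (k₃ , f₃) (k₄ , f₄) =
      let (d , 2+K≡1+2d) = twiceOdd-sum k₁ k₂ k₃ k₄ (gram-expansionℤ Q u u f₁ f₂ f₃ f₄
            (trans (form2-sym q₁ u) f₁) (trans (form2-sym q₂ u) f₂) (trans (form2-sym q₃ u) f₃) (trans (form2-sym q₄ u) f₄)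
            (trans (isCircle pu) (sym fromℤ-[-2])))
      in d ℤ.- k₁ , d ℤ.- k₂ , d ℤ.- k₃ , d ℤ.- k₄ , curvature-coefficients k₁ k₂ k₃ k₄ b₁ b₂ b₃ b₄ C d 2+K≡1+2d
           (gram-expansionℤ Q u e₁ f₁ f₂ f₃ f₄
             (trans (form2-e₁ q₁) h₁) (trans (form2-e₁ q₂) h₂) (trans (form2-e₁ q₃) h₃) (trans (form2-e₁ q₄) h₄)
             (trans (form2-e₁ u) hC))

  reflect-in-packing : ∀ {a b x y} → DescartesQuadruple a b x y → P a → P b → P y → P (reflect a b y x)
  reflect-in-packing {a} {b} {x} {y} Q pa pb py =
    add a b y (reflect a b y x) pa pb py tangent₁₂ tangent₂₃ tangent₁₃ isCircle₄ tangent₄₁ tangent₄₂ tangent₄₃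
    where open DescartesQuadruple (reflect-quadruple Q)

  bead-in-packing : ∀ {a b c d} (Q : DescartesQuadruple a b c d) → P a → P b → P c → P d → ∀ n → P (Necklace.bead Q n)
  bead-in-packing Q pa pb pc pd zero = pc
  bead-in-packing Q pa pb pc pd 1 = pd
  bead-in-packing Q pa pb pc pd (suc (suc n)) =
    reflect-in-packing (Necklace.bead-quadruple Q n) pa pb (bead-in-packing Q pa pb pc pd (suc n))

  D₀ D₁ D₂ D₃ : Circle
  D₀ = lookup D zero
  D₁ = lookup D (suc zero)
  D₂ = lookup D (suc (suc zero))
  D₃ = lookup D (suc (suc (suc zero)))

  d₀ : P D₀
  d₀ = initial zero
  d₁ : P D₁
  d₁ = initial (suc zero)
  d₂ : P D₂
  d₂ = initial (suc (suc zero))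
  d₃ : P D₃
  d₃ = initial (suc (suc (suc zero)))

  root-quadruple : DescartesQuadruple D₀ D₁ D₂ D₃
  root-quadruple = record
    { isCircle₁ = proj₁ isD _ ; isCircle₂ = proj₁ isD _ ; isCircle₃ = proj₁ isD _ ; isCircle₄ = proj₁ isD _
    ; tangent₁₂ = proj₂ isD _ _ (λ ()) ; tangent₁₃ = proj₂ isD _ _ (λ ()) ; tangent₁₄ = proj₂ isD _ _ (λ ())
    ; tangent₂₃ = proj₂ isD _ _ (λ ()) ; tangent₂₄ = proj₂ isD _ _ (λ ()) ; tangent₃₄ = proj₂ isD _ _ (λ ()) }

  Q₀ : DescartesQuadruple D₀ D₁ D₂ D₃
  Q₀ = root-quadruple
  Q₁ : DescartesQuadruple D₁ D₀ D₂ D₃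
  Q₁ = swap₁₂ root-quadruple
  Q₂ : DescartesQuadruple D₂ D₀ D₁ D₃
  Q₂ = swap₁₂ (swap₂₃ root-quadruple)
  Q₃ : DescartesQuadruple D₃ D₀ D₁ D₂
  Q₃ = rotate-last root-quadruple

  Through : Circle → Circle → Set
  Through u v = ∃ λ c → ∃ λ d → DescartesQuadruple u v c d × P c × P d

  through : ∀ i j → i ≢ j → Through (lookup D i) (lookup D j)
  through zero zero 0≢0 = ⊥-elim (0≢0 refl)
  through zero (suc zero) _ = _ , _ , Q₀ , d₂ , d₃
  through zero (suc (suc zero)) _ = _ , _ , swap₂₃ Q₀ , d₁ , d₃
  through zero (suc (suc (suc zero))) _ = _ , _ , swap₂₃ (swap₃₄ Q₀) , d₁ , d₂
  through (suc zero) zero _ = _ , _ , Q₁ , d₂ , d₃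
  through (suc zero) (suc zero) 1≢1 = ⊥-elim (1≢1 refl)
  through (suc zero) (suc (suc zero)) _ = _ , _ , swap₂₃ Q₁ , d₀ , d₃
  through (suc zero) (suc (suc (suc zero))) _ = _ , _ , swap₂₃ (swap₃₄ Q₁) , d₀ , d₂
  through (suc (suc zero)) zero _ = _ , _ , Q₂ , d₁ , d₃
  through (suc (suc zero)) (suc zero) _ = _ , _ , swap₂₃ Q₂ , d₀ , d₃
  through (suc (suc zero)) (suc (suc zero)) 2≢2 = ⊥-elim (2≢2 refl)
  through (suc (suc zero)) (suc (suc (suc zero))) _ = _ , _ , swap₂₃ (swap₃₄ Q₂) , d₀ , d₁
  through (suc (suc (suc zero))) zero _ = _ , _ , Q₃ , d₁ , d₂
  through (suc (suc (suc zero))) (suc zero) _ = _ , _ , swap₂₃ Q₃ , d₀ , d₂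
  through (suc (suc (suc zero))) (suc (suc zero)) _ = _ , _ , swap₂₃ (swap₃₄ Q₃) , d₀ , d₁
  through (suc (suc (suc zero))) (suc (suc (suc zero))) 3≢3 = ⊥-elim (3≢3 refl)

  quadruple-containing : ∀ {u} → P u → ∃ λ x → P x × Through u x
  quadruple-containing (initial zero) = _ , d₁ , through zero (suc zero) (λ ())
  quadruple-containing (initial (suc i)) = _ , d₀ , through (suc i) zero (λ ())
  quadruple-containing (add a b c w pa pb pc tab tbc tac w-circle twa twb twc) =
    a , pa , b , c , rotate-last (added-quadruple pa pb pc tab tbc tac w-circle twa twb twc) , pb , pc

  Link : Circle → Circle → Set
  Link u v = P u × Tangent u v × CoprimeQ (curv u) (curv v)

  data Chain : Circle → Circle → Set where
    [_] : ∀ {u} → P u → Chain u u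
    _∷_ : ∀ {u v w} → Link u v → Chain v w → Chain u w

  infixr 5 _∷_ _++_

  _++_ : ∀ {u v w} → Chain u v → Chain v w → Chain u w
  [ _ ] ++ c′ = c′
  (l ∷ c) ++ c′ = l ∷ (c ++ c′)

  start : ∀ {u v} → Chain u v → P u
  start [ pu ] = pu
  start ((pu , _) ∷ _) = pu

  reverse : ∀ {u v} → Chain u v → Chain v u
  reverse [ pu ] = [ pu ]
  reverse {u} ((pu , t , coprime) ∷ c) = reverse c ++ (start c , Tangent-sym u _ t , (λ d d∣v d∣u → coprime d d∣u d∣v)) ∷ [ pu ]

  toSequence : ∀ {u v} → Chain u v → Σ ℕ λ m → Σ (Fin (suc m) → Circle) λ seq →
    (seq zero ≡ u) × (seq (fromℕ m) ≡ v) × (∀ k → P (seq k)) ×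
    (∀ (j : Fin m) → Tangent (seq (inject₁ j)) (seq (suc j)) × CoprimeQ (curv (seq (inject₁ j))) (curv (seq (suc j))))
  toSequence {u} [ pu ] = 0 , (λ _ → u) , refl , refl , (λ _ → pu) , λ ()
  toSequence {u} ((pu , t , coprime) ∷ c) =
    let (m , seq , first , last , in-packing , links) = toSequence c
        in-packing′ : ∀ k → P ((u Vector.∷ seq) k)
        in-packing′ = λ where
          zero → pu
          (suc k) → in-packing k
        links′ : ∀ (j : Fin (suc m)) → Tangent ((u Vector.∷ seq) (inject₁ j)) ((u Vector.∷ seq) (suc j)) ×
                   CoprimeQ (curv ((u Vector.∷ seq) (inject₁ j))) (curv ((u Vector.∷ seq) (suc j)))
        links′ = λ where
          zero → subst (Tangent u) (sym first) t , subst (λ x → CoprimeQ (curv u) (curv x)) (sym first) coprime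
          (suc j) → links j
    in suc m , u Vector.∷ seq , refl , last , in-packing′ , links′

  module _ (integral : Integral D) (prim : Primitive D) where

    curvatureℤ : ∀ {w} → P w → ∃ λ C → curv w ≡ fromℤ C
    curvatureℤ {w} pw = proj₁ (integral w pw) , trans (proj₂ (integral w pw)) (sym (fromℤ≡/1 (proj₁ (integral w pw))))

    quadruple-divisor≡1 : ∀ {q₁ q₂ q₃ q₄} → DescartesQuadruple q₁ q₂ q₃ q₄ → P q₁ → P q₂ → P q₃ → P q₄ →
      ∀ {b₁ b₂ b₃ b₄} → curv q₁ ≡ fromℤ b₁ → curv q₂ ≡ fromℤ b₂ → curv q₃ ≡ fromℤ b₃ → curv q₄ ≡ fromℤ b₄ →
      ∀ d → + d ℤ.∣ b₁ → + d ℤ.∣ b₂ → + d ℤ.∣ b₃ → + d ℤ.∣ b₄ → d ≡ 1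
    quadruple-divisor≡1 Q p₁ p₂ p₃ p₄ h₁ h₂ h₃ h₄ d d₁ d₂ d₃ d₄ = prim d divides-all
      where
      divides-all : ∀ w → P w → d ∣ℚ curv w
      divides-all w pw =
        let (C , hC) = curvatureℤ pw
            (a₁ , a₂ , a₃ , a₄ , C≡) = curvature-combination Q p₁ p₂ p₃ p₄ pw h₁ h₂ h₃ h₄ hC
        in subst (d ∣ℚ_) (sym hC) (∣⇒∣ℚ (subst (+ d ℤ.∣_) (sym C≡) (∣-combination a₁ a₂ a₃ a₄ d₁ d₂ d₃ d₄)))

    -- A prime dividing b₁, b₂, b₃ divides b₄² by the Descartes relation, hence all four.
    no-prime-divides-three : ∀ {q₁ q₂ q₃ q₄} → DescartesQuadruple q₁ q₂ q₃ q₄ → P q₁ → P q₂ → P q₃ → P q₄ →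
      ∀ {b₁ b₂ b₃} → curv q₁ ≡ fromℤ b₁ → curv q₂ ≡ fromℤ b₂ → curv q₃ ≡ fromℤ b₃ →
      ∀ p → Prime p → + p ℤ.∣ b₁ → + p ℤ.∣ b₂ → + p ℤ.∣ b₃ → ⊥
    no-prime-divides-three Q p₁ p₂ p₃ p₄ h₁ h₂ h₃ p p-prime p∣b₁@(divides m₁ b₁≡) p∣b₂@(divides m₂ b₂≡) p∣b₃@(divides m₃ b₃≡) =
      ℕ.nonTrivial⇒≢1 {{prime⇒nonTrivial p-prime}} (quadruple-divisor≡1 Q p₁ p₂ p₃ p₄ h₁ h₂ h₃ h₄ p p∣b₁ p∣b₂ p∣b₃ p∣b₄)
      where
      b₄ = proj₁ (curvatureℤ p₄)
      h₄ = proj₂ (curvatureℤ p₄)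
      M = m₁ ℤ.+ m₂ ℤ.+ m₃
      X = M ℤ.* M ℤ.* + p ℤ.+ + 2 ℤ.* M ℤ.* b₄ ℤ.- + 2 ℤ.* + p ℤ.* (m₁ ℤ.* m₁ ℤ.+ m₂ ℤ.* m₂ ℤ.+ m₃ ℤ.* m₃)
      square-identity : b₄ ℤ.* b₄ ≡ X ℤ.* + p ℤ.-
        expansionℤ (m₁ ℤ.* + p) (m₂ ℤ.* + p) (m₃ ℤ.* + p) b₄ (m₁ ℤ.* + p) (m₂ ℤ.* + p) (m₃ ℤ.* + p) b₄
      square-identity = solve 5 (λ m₁ m₂ m₃ p b₄ → let M = m₁ :+ m₂ :+ m₃ in
          b₄ :* b₄ := (M :* M :* p :+ con (+ 2) :* M :* b₄ :- con (+ 2) :* p :* (m₁ :* m₁ :+ m₂ :* m₂ :+ m₃ :* m₃)) :* p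
                      :- E.expansion (m₁ :* p) (m₂ :* p) (m₃ :* p) b₄ (m₁ :* p) (m₂ :* p) (m₃ :* p) b₄) refl
        m₁ m₂ m₃ (+ p) b₄
        where
        open ℤ-Solver
        module E = Polynomials (ℤ-syntax 5)
      b₄²≡Xp : b₄ ℤ.* b₄ ≡ X ℤ.* + p
      b₄²≡Xp = trans square-identity (trans
        (cong (λ z → X ℤ.* + p ℤ.- z) (descartes-relation Q (trans h₁ (cong fromℤ b₁≡)) (trans h₂ (cong fromℤ b₂≡))
                                                             (trans h₃ (cong fromℤ b₃≡)) h₄))
        (ℤ.+-identityʳ (X ℤ.* + p)))
      p∣b₄ : + p ℤ.∣ b₄
      p∣b₄ = [ ℤ.∣ᵤ⇒∣ , ℤ.∣ᵤ⇒∣ ]′ (euclidsLemma ℤ.∣ b₄ ∣ ℤ.∣ b₄ ∣ p-prime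
        (subst (p ℕ.∣_) (ℤ.abs-* b₄ b₄) (ℤ.∣⇒∣ᵤ (divides X b₄²≡Xp))))

    -- A bead of the necklace around a and b as chosen by coprime-necklace-index: a prime of A B
    -- dividing C₀ and C₁ would divide three curvatures of a quadruple.
    common-coprime-neighbour : ∀ {a b c d} → DescartesQuadruple a b c d → P a → P b → P c → P d →
      ∀ {A B} → curv a ≡ fromℤ A → curv b ≡ fromℤ B → A ≢ + 0 → B ≢ + 0 →
      ∃ λ e → P e × Tangent a e × Tangent e b × CoprimeQ (curv a) (curv e) × CoprimeQ (curv e) (curv b)
    common-coprime-neighbour {a} {b} {c} {d} Q pa pb pc pd {A} {B} hA hB A≢0 B≢0 =
      bead n , bead-in-packing Q pa pb pc pd n , tangent₁₃ , tangent₃₂ ,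
      coprime-to-bead {a} A≢0 hA A⇒m , λ k k∣e k∣b → coprime-to-bead {b} B≢0 hB B⇒m k k∣b k∣e
      where
      open Necklace Q
      C₀ = proj₁ (curvatureℤ pc)
      C₁ = proj₁ (curvatureℤ pd)
      hC₀ = proj₂ (curvatureℤ pc)
      hC₁ = proj₂ (curvatureℤ pd)
      m = ℤ.∣ A ∣ ℕ.* ℤ.∣ B ∣
      instance
        m≢0 : ℕ.NonZero m
        m≢0 = ℕ.m*n≢0 ℤ.∣ A ∣ ℤ.∣ B ∣ {{ℤ.≢-nonZero A≢0}} {{ℤ.≢-nonZero B≢0}}
      A⇒m : ∀ {p} → + p ℤ.∣ A → p ℕ.∣ m
      A⇒m p∣A = ℕ.∣m⇒∣m*n ℤ.∣ B ∣ (ℤ.∣⇒∣ᵤ p∣A)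
      B⇒m : ∀ {p} → + p ℤ.∣ B → p ℕ.∣ m
      B⇒m p∣B = ℕ.∣n⇒∣m*n ℤ.∣ A ∣ (ℤ.∣⇒∣ᵤ p∣B)
      no-common : ∀ p → Prime p → p ℕ.∣ m → + p ℤ.∣ C₀ → + p ℤ.∣ C₁ → ⊥
      no-common p p-prime p∣m p∣C₀ p∣C₁ with euclidsLemma ℤ.∣ A ∣ ℤ.∣ B ∣ p-prime p∣m
      ... | inj₁ p∣A = no-prime-divides-three (swap₃₄ (swap₂₃ Q)) pa pc pd pb hA hC₀ hC₁ p p-prime (ℤ.∣ᵤ⇒∣ p∣A) p∣C₀ p∣C₁
      ... | inj₂ p∣B = no-prime-divides-three (swap₃₄ (swap₂₃ (swap₁₂ Q))) pb pc pd pa hB hC₀ hC₁ p p-prime (ℤ.∣ᵤ⇒∣ p∣B) p∣C₀ p∣C₁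
      n = proj₁ (coprime-necklace-index m A B C₀ C₁ no-common)
      open DescartesQuadruple (bead-quadruple n)
      coprime-to-bead : ∀ {q X} → X ≢ + 0 → curv q ≡ fromℤ X → (∀ {p} → + p ℤ.∣ X → p ℕ.∣ m) → CoprimeQ (curv q) (curv (bead n))
      coprime-to-bead X≢0 hX X⇒m k k∣q k∣e = no-common-prime⇒coprime X≢0
        (λ p p-prime p∣X p∣Z → proj₂ (coprime-necklace-index m A B C₀ C₁ no-common) p p-prime (X⇒m p∣X) p∣Z) k
        (∣ℚ⇒∣ (subst (k ∣ℚ_) hX k∣q)) (∣ℚ⇒∣ (subst (k ∣ℚ_) (bead-curvature hA hB hC₀ hC₁ n) k∣e))

    NonLine : Circle → Set
    NonLine w = ∃ λ W → curv w ≡ fromℤ W × W ≢ + 0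

    line-or-nonLine : ∀ {w} → P w → curv w ≡ fromℤ (+ 0) ⊎ NonLine w
    line-or-nonLine pw with proj₁ (curvatureℤ pw) ℤ.≟ + 0
    ... | yes W≡0 = inj₁ (trans (proj₂ (curvatureℤ pw)) (cong fromℤ W≡0))
    ... | no W≢0  = inj₂ (proj₁ (curvatureℤ pw) , proj₂ (curvatureℤ pw) , W≢0)

    -- With three lines the Descartes relation forces the fourth curvature to vanish too,
    -- and then 0 would divide every curvature.
    ¬three-lines : ∀ {q₁ q₂ q₃ q₄} → DescartesQuadruple q₁ q₂ q₃ q₄ → P q₁ → P q₂ → P q₃ → P q₄ →
      curv q₁ ≡ fromℤ (+ 0) → curv q₂ ≡ fromℤ (+ 0) → curv q₃ ≡ fromℤ (+ 0) → ⊥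
    ¬three-lines Q p₁ p₂ p₃ p₄ h₁ h₂ h₃ =
      0≢1 (quadruple-divisor≡1 Q p₁ p₂ p₃ p₄ h₁ h₂ h₃ h₄ 0 ∣+0 ∣+0 ∣+0 (subst (+ 0 ℤ.∣_) (sym B≡0) ∣+0))
      where
      0≢1 : 0 ≢ 1
      0≢1 ()
      B = proj₁ (curvatureℤ p₄)
      h₄ = proj₂ (curvatureℤ p₄)
      square : ∀ B → B ℤ.* B ≡ ℤ.- expansionℤ (+ 0) (+ 0) (+ 0) B (+ 0) (+ 0) (+ 0) B
      square = solve 1 (λ B → B :* B := :- P.expansion (con (+ 0)) (con (+ 0)) (con (+ 0)) B (con (+ 0)) (con (+ 0)) (con (+ 0)) B) refl
        where
        open ℤ-Solver
        module P = Polynomials (ℤ-syntax 1)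
      B≡0 : B ≡ + 0
      B≡0 = reduce (ℤ.i*j≡0⇒i≡0∨j≡0 B (trans (square B) (cong ℤ.-_ (descartes-relation Q h₁ h₂ h₃ h₄))))

    at-most-two-lines : ∀ {q₁ q₂ q₃ q₄} → DescartesQuadruple q₁ q₂ q₃ q₄ → P q₁ → P q₂ → P q₃ → P q₄ →
      NonLine q₁ ⊎ NonLine q₂ ⊎ NonLine q₃
    at-most-two-lines Q p₁ p₂ p₃ p₄ with line-or-nonLine p₁ | line-or-nonLine p₂ | line-or-nonLine p₃
    ... | inj₂ nonLine | _ | _ = inj₁ nonLine
    ... | inj₁ _ | inj₂ nonLine | _ = inj₂ (inj₁ nonLine)
    ... | inj₁ _ | inj₁ _ | inj₂ nonLine = inj₂ (inj₂ nonLine)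
    ... | inj₁ h₁ | inj₁ h₂ | inj₁ h₃ = ⊥-elim (¬three-lines Q p₁ p₂ p₃ p₄ h₁ h₂ h₃)

    LineNeighbour : Circle → Set
    LineNeighbour L = ∃ λ w → P w × Tangent L w × CoprimeQ (curv L) (curv w) × NonLine w

    module _ {L} (pL : P L) (L-line : curv L ≡ fromℤ (+ 0)) where

      -- The Descartes relation with curvatures 0, 0, Y, Z reads (Y − Z)² = 0, and then
      -- |Y| divides all four curvatures.
      two-lines : ∀ {x y z} → DescartesQuadruple L x y z → P x → P y → P z → ∀ {Y Z} →
        curv x ≡ fromℤ (+ 0) → curv y ≡ fromℤ Y → curv z ≡ fromℤ Z → LineNeighbour L
      two-lines {y = y} Q px py pz {Y} {Z} hx hy hz = y , py , DescartesQuadruple.tangent₁₃ Q , coprime , Y , hy , Y≢0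
        where
        square : ∀ Y Z → (Y ℤ.- Z) ℤ.* (Y ℤ.- Z) ≡ ℤ.- expansionℤ (+ 0) (+ 0) Y Z (+ 0) (+ 0) Y Z
        square = solve 2 (λ Y Z → (Y :- Z) :* (Y :- Z) := :- P.expansion (con (+ 0)) (con (+ 0)) Y Z (con (+ 0)) (con (+ 0)) Y Z) refl
          where
          open ℤ-Solver
          module P = Polynomials (ℤ-syntax 2)
        Y-Z≡0 : Y ℤ.- Z ≡ + 0
        Y-Z≡0 = reduce (ℤ.i*j≡0⇒i≡0∨j≡0 (Y ℤ.- Z)
          (trans (square Y Z) (cong ℤ.-_ (descartes-relation Q L-line hx hy hz))))
        ∣Y∣≡1 : ℤ.∣ Y ∣ ≡ 1
        ∣Y∣≡1 = quadruple-divisor≡1 Q pL px py pz L-line hx hy hz ℤ.∣ Y ∣ ∣+0 ∣+0 ℤ.∣m∣∣m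
          (subst (+ ℤ.∣ Y ∣ ℤ.∣_) (ℤ.i-j≡0⇒i≡j Y Z Y-Z≡0) ℤ.∣m∣∣m)
        coprime : CoprimeQ (curv L) (curv y)
        coprime d _ d∣y = ℕ.∣1⇒≡1 (subst (d ℕ.∣_) ∣Y∣≡1 (ℤ.∣⇒∣ᵤ (∣ℚ⇒∣ (subst (d ∣ℚ_) hy d∣y))))
        Y≢0 : Y ≢ + 0
        Y≢0 Y≡0 = 0≢1 (trans (sym (cong ℤ.∣_∣ Y≡0)) ∣Y∣≡1)
          where
          0≢1 : 0 ≢ 1
          0≢1 ()

      -- Reflect the circle of largest curvature in absolute value until a second line appears.
      mutual
        descent : ∀ N {x y z} → DescartesQuadruple L x y z → P x → P y → P z → ∀ {X Y Z} →
          curv x ≡ fromℤ X → curv y ≡ fromℤ Y → curv z ≡ fromℤ Z → ℤ.∣ X ∣ ℕ.+ ℤ.∣ Y ∣ ℕ.+ ℤ.∣ Z ∣ ≤ N → LineNeighbour L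
        descent N Q px py pz {X} {Y} {Z} hx hy hz bound with X ℤ.≟ + 0 | Y ℤ.≟ + 0 | Z ℤ.≟ + 0
        ... | yes X≡0 | _ | _ = two-lines Q px py pz (trans hx (cong fromℤ X≡0)) hy hz
        ... | no _ | yes Y≡0 | _ = two-lines (swap₂₃ Q) py px pz (trans hy (cong fromℤ Y≡0)) hx hz
        ... | no _ | no _ | yes Z≡0 = two-lines (swap₂₃ (swap₃₄ Q)) pz px py (trans hz (cong fromℤ Z≡0)) hx hy
        ... | no X≢0 | no Y≢0 | no Z≢0 with largest ℤ.∣ X ∣ ℤ.∣ Y ∣ ℤ.∣ Z ∣
        ...   | inj₁ (x≤z , y≤z) = reflect-largest N Q px py pz hx hy hz X≢0 Y≢0 x≤z y≤z bound
        ...   | inj₂ (inj₁ (x≤y , z≤y)) = reflect-largest N (swap₃₄ Q) px pz py hx hz hy X≢0 Z≢0 x≤y z≤y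
                  (subst (_≤ N) (+-reorder₁₃₂ ℤ.∣ X ∣ ℤ.∣ Y ∣ ℤ.∣ Z ∣) bound)
        ...   | inj₂ (inj₂ (y≤x , z≤x)) = reflect-largest N (swap₃₄ (swap₂₃ Q)) py pz px hy hz hx Y≢0 Z≢0 y≤x z≤x
                  (subst (_≤ N) (+-reorder₂₃₁ ℤ.∣ X ∣ ℤ.∣ Y ∣ ℤ.∣ Z ∣) bound)

        reflect-largest : ∀ N {x y z} → DescartesQuadruple L x y z → P x → P y → P z → ∀ {X Y Z} →
          curv x ≡ fromℤ X → curv y ≡ fromℤ Y → curv z ≡ fromℤ Z → X ≢ + 0 → Y ≢ + 0 →
          ℤ.∣ X ∣ ≤ ℤ.∣ Z ∣ → ℤ.∣ Y ∣ ≤ ℤ.∣ Z ∣ → ℤ.∣ X ∣ ℕ.+ ℤ.∣ Y ∣ ℕ.+ ℤ.∣ Z ∣ ≤ N → LineNeighbour L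
        reflect-largest zero Q px py pz {X} {Y} {Z} hx hy hz X≢0 Y≢0 x≤z y≤z bound =
          ⊥-elim (ℕ.<⇒≱ (1≤∣∣ X≢0) (ℕ.≤-trans (ℕ.≤-trans (ℕ.m≤m+n ℤ.∣ X ∣ ℤ.∣ Y ∣) (ℕ.m≤m+n _ ℤ.∣ Z ∣)) bound))
        reflect-largest (suc N) {x} {y} {z} Q px py pz {X} {Y} {Z} hx hy hz X≢0 Y≢0 x≤z y≤z bound =
          descent N (reflect-quadruple (swap₃₄ Q)) px py (reflect-in-packing (swap₃₄ Q) pL px py) hx hy reflected
            (ℕ.≤-pred (ℕ.<-≤-trans (ℕ.+-monoʳ-< (ℤ.∣ X ∣ ℕ.+ ℤ.∣ Y ∣)
              (reflection-shrinks X≢0 Y≢0 x≤z y≤z (descartes-relation Q L-line hx hy hz))) bound))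
          where
          reflected : curv (reflect L x y z) ≡ fromℤ (+ 2 ℤ.* (+ 0 ℤ.+ X ℤ.+ Y) ℤ.- Z)
          reflected = trans (cong₂ (λ s t → two * s - t) (cong₂ _+_ (cong₂ _+_ L-line hx) hy) hz)
                            (sym (fromℤ-reflect (+ 0) X Y Z))

      line-neighbour : LineNeighbour L
      line-neighbour =
        let (x , px , y , z , Q , py , pz) = quadruple-containing pL
            (X , hX) = curvatureℤ px
            (Y , hY) = curvatureℤ py
            (Z , hZ) = curvatureℤ pz
        in descent _ Q px py pz hX hY hZ ℕ.≤-refl

    pair-chain : ∀ {a b c d} → DescartesQuadruple a b c d → P a → P b → P c → P d → NonLine a → NonLine b → Chain a b
    pair-chain Q pa pb pc pd (A , hA , A≢0) (B , hB , B≢0) =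
      let (e , pe , a-e , e-b , coprime-ae , coprime-eb) = common-coprime-neighbour Q pa pb pc pd hA hB A≢0 B≢0
      in (pa , a-e , coprime-ae) ∷ (pe , e-b , coprime-eb) ∷ [ pb ]

    module _ (j : Fin 4) (root-nonLine : NonLine (lookup D j)) where

      nonLine-to-root : ∀ {u} → P u → NonLine u → Chain u (lookup D j)
      nonLine-to-root (initial i) nonLine with i ≟ j
      ... | yes refl = [ initial i ]
      ... | no i≢j = let (c , d , Q , pc , pd) = through i j i≢j in pair-chain Q (initial i) (initial j) pc pd nonLine root-nonLine
      nonLine-to-root pw@(add a b c w pa pb pc tab tbc tac w-circle twa twb twc) w-nonLine =
        [ via-a , [ via-b , via-c ]′ ]′ (at-most-two-lines (added-quadruple pa pb pc tab tbc tac w-circle twa twb twc) pa pb pc pw)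
        where
        Q : DescartesQuadruple w a b c
        Q = rotate-last (added-quadruple pa pb pc tab tbc tac w-circle twa twb twc)
        via-a : NonLine a → Chain w (lookup D j)
        via-a a-nonLine = pair-chain Q pw pa pb pc w-nonLine a-nonLine ++ nonLine-to-root pa a-nonLine
        via-b : NonLine b → Chain w (lookup D j)
        via-b b-nonLine = pair-chain (swap₂₃ Q) pw pb pa pc w-nonLine b-nonLine ++ nonLine-to-root pb b-nonLine
        via-c : NonLine c → Chain w (lookup D j)
        via-c c-nonLine = pair-chain (swap₂₃ (swap₃₄ Q)) pw pc pa pb w-nonLine c-nonLine ++ nonLine-to-root pc c-nonLine

      to-root : ∀ {u} → P u → Chain u (lookup D j)
      to-root {u} pu = [ via-neighbour , nonLine-to-root pu ]′ (line-or-nonLine pu)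
        where
        via-neighbour : curv u ≡ fromℤ (+ 0) → Chain u (lookup D j)
        via-neighbour line = let (w , pw , t , coprime , w-nonLine) = line-neighbour pu line
                             in (pu , t , coprime) ∷ nonLine-to-root pw w-nonLine

    root : ∃ λ j → NonLine (lookup D j)
    root = [ (zero ,_) , [ (suc zero ,_) , (suc (suc zero) ,_) ]′ ]′ (at-most-two-lines root-quadruple d₀ d₁ d₂ d₃)

    chain : ∀ {u v} → P u → P v → Chain u v
    chain pu pv = to-root (proj₁ root) (proj₂ root) pu ++ reverse (to-root (proj₁ root) (proj₂ root) pv)

corollary4p7 : (D : Vec Circle 4) → IsDescartes D → Integral D → Primitive D →
    (C C′ : Circle) → InPacking D C → InPacking D C′ →
    Σ ℕ λ m → Σ (Fin (suc m) → Circle) λ seq →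
      (seq zero ≡ C) × (seq (fromℕ m) ≡ C′) × (∀ k → InPacking D (seq k)) ×
      (∀ (j : Fin m) → Tangent (seq (inject₁ j)) (seq (suc j))
                      × CoprimeQ (curv (seq (inject₁ j))) (curv (seq (suc j))))
corollary4p7 D isD integral prim C C′ pC pC′ = toSequence (chain integral prim pC pC′)
  where open Packing D isD
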